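{- A simple graph $G$ has a unique Sachs subgraph if and only if $G$ can be reduced to a family of independent odd cycles by repeatedly deleting pendant edges together with their end-vertices.
   Context: A simple graph has no loops or multiple edges. A Sachs subgraph of $G$ is a spanning subgraph each of whose components is either a $K_2$ (single edge) or a cycle (for simple graphs there are no loops). A pendant edge is an edge incident with a vertex of degree $1$; deleting it together with its end-vertices means deleting both of its end-vertices and all edges incident with them. A family of cycles is independent if the cycles are vertex-disjoint and no edge joins vertices of two different cycles of the family; "reduced to a family of independent odd cycles" means the resulting graph is exactly the vertex-disjoint union of such cycles, each of odd length (the empty family allowed). -}

module Defs where

open import Data.Nat using (ℕ; _≤_)
open import Data.Nat.DivMod using (_%_)
open import Data.Unit using (⊤)
open import Data.Empty using (⊥)
open import Data.Bool using (Bool; true; false; _∧_; not)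
open import Data.Fin using (Fin)
open import Data.Fin.Properties using (_≟_)
open import Data.List using (List; []; _∷_; _++_; [_]; length; concatMap)
open import Data.List.Membership.Propositional using (_∈_)
open import Data.List.Relation.Unary.Any using (Any)
open import Data.List.Relation.Unary.All using (All)
open import Data.List.Relation.Unary.Unique.Propositional using (Unique)
open import Data.Product using (Σ; ∃; ∃-syntax; _×_; _,_)
open import Data.Sum using (_⊎_)
open import Relation.Nullary.Decidable using (⌊_⌋)
open import Relation.Binary.PropositionalEquality using (_≡_)
open import Relation.Binary.Construct.Closure.ReflexiveTransitive using (Star)

record Graph (n : ℕ) : Set where
  field
    adj     : Fin n → Fin n → Bool
    symm    : ∀ u v → adj u v ≡ adj v u
    irrefl  : ∀ u → adj u u ≡ false
open Graph public

VSet : ℕ → Set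
VSet n = Fin n → Bool

ERel : ℕ → Set
ERel n = Fin n → Fin n → Bool

data Consec {A : Set} : List A → A → A → Set where
  here  : ∀ {x y xs} → Consec (x ∷ y ∷ xs) x y
  there : ∀ {z x y xs} → Consec xs x y → Consec (z ∷ xs) x y

CycEdge : ∀ {n} → List (Fin n) → Fin n → Fin n → Set
CycEdge []       u v = ⊥
CycEdge (c ∷ cs) u v = Consec ((c ∷ cs) ++ [ c ]) u v ⊎ Consec ((c ∷ cs) ++ [ c ]) v u

data Piece (n : ℕ) : Set where
  k2    : Fin n → Fin n → Piece n
  cycle : List (Fin n) → Piece n

verts : ∀ {n} → Piece n → List (Fin n)
verts (k2 u v)     = u ∷ v ∷ []
verts (cycle cs)   = cs

PieceEdge : ∀ {n} → Piece n → Fin n → Fin n → Set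
PieceEdge (k2 a b)   u v = (u ≡ a × v ≡ b) ⊎ (u ≡ b × v ≡ a)
PieceEdge (cycle cs) u v = CycEdge cs u v

-- Well-formedness of a piece (cycles have at least 3 vertices;
-- distinctness of vertices is imposed globally by Decomposition).
WfPiece : ∀ {n} → Piece n → Set
WfPiece (k2 u v)   = ⊤
WfPiece (cycle cs) = 3 ≤ length cs

IsOddCycle : ∀ {n} → Piece n → Set
IsOddCycle (k2 u v)   = ⊥
IsOddCycle (cycle cs) = length cs % 2 ≡ 1

record Decomposition {n : ℕ} (S : VSet n) (R : ERel n) (ps : List (Piece n)) : Set where
  field
    wf       : All WfPiece ps
    disjoint : Unique (concatMap verts ps)
    cover    : ∀ x → (S x ≡ true → x ∈ concatMap verts ps) × (x ∈ concatMap verts ps → S x ≡ true)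
    edges    : ∀ u v → (R u v ≡ true → Any (λ p → PieceEdge p u v) ps) × (Any (λ p → PieceEdge p u v) ps → R u v ≡ true)

allV : ∀ {n} → VSet n
allV _ = true

IsSachs : ∀ {n} → Graph n → ERel n → Set
IsSachs {n} G H =
  (∀ u v → H u v ≡ true → adj G u v ≡ true) ×
  ∃[ ps ] Decomposition allV H ps

UniqueSachs : ∀ {n} → Graph n → Set
UniqueSachs {n} G =
  ∃[ H ] (IsSachs G H × (∀ H′ → IsSachs G H′ → ∀ u v → H′ u v ≡ H u v))

induced : ∀ {n} → Graph n → VSet n → ERel n
induced G S u v = adj G u v ∧ (S u ∧ S v)

PendantStep : ∀ {n} → Graph n → VSet n → VSet n → Set
PendantStep G S S′ =
  ∃[ u ] ∃[ v ]
    ( S u ≡ true × S v ≡ true × adj G u v ≡ true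
    × (∀ w → S w ≡ true → adj G u w ≡ true → w ≡ v)
    × (∀ w → S′ w ≡ (S w ∧ (not ⌊ w ≟ u ⌋ ∧ not ⌊ w ≟ v ⌋))) )

IndepOddCycles : ∀ {n} → Graph n → VSet n → Set
IndepOddCycles G S =
  ∃[ ps ] (Decomposition S (induced G S) ps × All IsOddCycle ps)

ReducibleToOddCycles : ∀ {n} → Graph n → Set
ReducibleToOddCycles G =
  ∃[ S ] (Star (PendantStep G) allV S × IndepOddCycles G S)

-- A pendant edge uv of G[S] is a K₂ of every Sachs subgraph, so the Sachs subgraphs of G[S] and of
-- G[S − u − v] correspond and uniqueness passes both ways along a reduction.  A family of independent odd
-- cycles has exactly one Sachs subgraph, itself: a vertex covered by a K₂ would force a perfect matching
-- of its odd cycle.  Conversely, once no pendant edge is left every vertex has two neighbours, and the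
-- unique Sachs subgraph H of G[S] is rigid: an even cycle of H could be swapped for a perfect matching, an
-- edge of G[S] outside H (more generally an even walk alternating with H between two cycles of H) yields
-- a rival family, and so does a K₂ of H, by growing an H-alternating path from it in both directions
-- until each end closes into a blossom or runs into a cycle of H.  Hence G[S] is H, a family of
-- independent odd cycles.

module Submission where

open import Defs
import Algebra.Solver.CommutativeMonoid
import Algebra.Solver.Monoid
open import Data.Bool using (true; _∧_; not)
open import Data.Bool.Properties using (⇔→≡) renaming (_≟_ to _≟ᵇ_)
open import Data.Empty using (⊥; ⊥-elim)
open import Data.Fin using (Fin)
open import Data.Fin.Properties using (_≟_; any?; all?; ¬∀⟶∃¬)
open import Data.List using (List; []; _∷_; _++_; [_]; _∷ʳ_; length; reverse; concatMap; filter; initLast; _∷ʳ′_)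
open import Data.List.Properties using (++-assoc; ++-identityʳ; ++-monoid; concatMap-++; length-++; length-reverse; length-tabulate; reverse-++; unfold-reverse; reverse-involutive; ∷-injectiveˡ; ∷-injectiveʳ; ∷ʳ-injective; filter-notAll)
open import Data.List.Membership.Propositional using (_∈_; _∉_; find; lose)
open import Data.List.Membership.Propositional.Properties using (∈-concatMap⁺; ∈-concatMap⁻; ∈-∃++; ∈-++⁺ˡ; ∈-++⁺ʳ; ∈-++⁻; ∈-filter⁺; ∈-filter⁻; ∈-allFin)
open import Data.List.Relation.Binary.Permutation.Propositional using (_↭_; ↭-refl; ↭-sym; ↭-trans; ↭-reflexive; prep; swap; ↭⇒↭ₛ)
open import Data.List.Relation.Binary.Permutation.Propositional.Properties using (∈-resp-↭; ↭-length; ↭-reverse; ++-comm; ++⁺; ++⁺ˡ; ++⁺ʳ; shift; ++-commutativeMonoid)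
import Data.List.Relation.Binary.Permutation.Setoid.Properties as ↭ₛ
open import Data.List.Relation.Unary.All as All using (All; []; _∷_)
import Data.List.Relation.Unary.All.Properties as All
open import Data.List.Relation.Unary.AllPairs using (AllPairs; []; _∷_)
import Data.List.Relation.Unary.AllPairs.Properties as AllPairs
open import Data.List.Relation.Unary.Any as Any using (Any; here; there)
import Data.List.Relation.Unary.Any.Properties as Any
open import Data.List.Relation.Unary.Linked as Linked using (Linked; []; [-]; _∷_)
open import Data.List.Relation.Unary.Unique.Propositional using (Unique)
open import Data.Nat using (ℕ; zero; suc; _+_; _≤_; _<_; z≤n; s≤s; parity)
open import Data.Nat.DivMod using (_%_)
open import Data.Nat.Properties using (+-comm; +-suc; +-identityʳ; m≤n+m; ≤-refl; ≤-trans; <-≤-trans; n≤1+n; ≤-pred; 1+n≰n)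
open import Data.Parity.Base as ℙ using (Parity; 0ℙ; 1ℙ; _⁻¹)
open import Data.Parity.Properties using (+-homo-+; suc-homo-⁻¹; ⁻¹-selfInverse; ⁻¹-injective; +-cancelʳ-≡; p+p≡0ℙ; p+p⁻¹≡1ℙ)
open import Data.Product using (∃-syntax; _×_; _,_; proj₁; proj₂)
open import Data.Sum using (_⊎_; inj₁; inj₂; [_,_]′)
open import Data.Unit using (tt)
open import Function using (_∘_; case_of_; mk⇔)
open import Relation.Binary.Construct.Closure.ReflexiveTransitive using (Star; ε; _◅_)
open import Relation.Binary.PropositionalEquality using (_≡_; _≢_; refl; sym; trans; cong; subst; setoid)
open import Relation.Nullary using (¬_; Dec; yes; no; ¬?)
open import Relation.Nullary.Decidable using (does; ⌊_⌋; dec-true; _×-dec_; _⊎-dec_; _→-dec_)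

module _ where

  private variable
    A B : Set
    R : A → A → Set
    x y z : A
    xs ys zs : List A

  -- Lists without repetition

  Unique-↭ : {A : Set} {xs ys : List A} → xs ↭ ys → Unique xs → Unique ys
  Unique-↭ {A = A} p = ↭ₛ.Unique-resp-↭ (setoid A) (↭⇒↭ₛ p)

  Unique-∷⁺ : x ∉ xs → Unique xs → Unique (x ∷ xs)
  Unique-∷⁺ {xs = xs} x∉ u = All.tabulate (λ {y} y∈ x≡y → x∉ (subst (_∈ xs) (sym x≡y) y∈)) ∷ u

  Unique-++⁺ : Unique xs → Unique ys → (∀ {x} → x ∈ xs → x ∉ ys) → Unique (xs ++ ys)
  Unique-++⁺ {ys = ys} uxs uys disj = AllPairs.++⁺ uxs uys
    (All.tabulate λ x∈ → All.tabulate λ {y} y∈ x≡y → disj x∈ (subst (_∈ ys) (sym x≡y) y∈))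

  Unique-++⁻ : ∀ xs → Unique (xs ++ ys) → Unique xs × Unique ys × (∀ {x} → x ∈ xs → x ∉ ys)
  Unique-++⁻ []       u = [] , u , λ ()
  Unique-++⁻ (x ∷ xs) (x∉ ∷ u) with Unique-++⁻ xs u
  ... | uxs , uys , disj =
    All.tabulate (λ y∈ → All.lookup x∉ (∈-++⁺ˡ y∈)) ∷ uxs , uys ,
    λ { (here refl) y∈ → All.lookup x∉ (∈-++⁺ʳ xs y∈) refl ; (there x∈) → disj x∈ }

  ∈-delete : ∀ xs → y ∈ xs ++ x ∷ ys → y ≢ x → y ∈ xs ++ ys
  ∈-delete []       (here y≡x) y≢x = ⊥-elim (y≢x y≡x)
  ∈-delete []       (there y∈) _   = y∈
  ∈-delete (_ ∷ xs) (here y≡x) _   = here y≡x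
  ∈-delete (_ ∷ xs) (there y∈) y≢x = there (∈-delete xs y∈ y≢x)

  ∈-undelete : ∀ xs → y ∈ xs ++ ys → y ∈ xs ++ x ∷ ys
  ∈-undelete []       y∈         = there y∈
  ∈-undelete (_ ∷ xs) (here y≡x) = here y≡x
  ∈-undelete (_ ∷ xs) (there y∈) = there (∈-undelete xs y∈)

  Unique-delete : ∀ xs → Unique (xs ++ x ∷ ys) → Unique (xs ++ ys)
  Unique-delete []       (_ ∷ u)  = u
  Unique-delete (_ ∷ xs) (x∉ ∷ u) = All.tabulate (All.lookup x∉ ∘ ∈-undelete xs) ∷ Unique-delete xs u

  length-delete : ∀ xs → length (xs ++ x ∷ ys) ≡ suc (length (xs ++ ys))
  length-delete []       = refl
  length-delete (_ ∷ xs) = cong suc (length-delete xs)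

  Unique⇒length≤ : Unique xs → (∀ {x} → x ∈ xs → x ∈ ys) → length xs ≤ length ys
  Unique⇒length≤ {xs = []}     _        _ = z≤n
  Unique⇒length≤ {xs = x ∷ xs} (x∉ ∷ u) sub with ∈-∃++ (sub (here refl))
  ... | as , bs , refl = subst (suc (length xs) ≤_) (sym (length-delete as))
    (s≤s (Unique⇒length≤ u λ y∈ → ∈-delete as (sub (there y∈)) λ { refl → All.lookup x∉ y∈ refl }))

  Unique-Fin⇒length≤ : ∀ {n} {xs : List (Fin n)} → Unique xs → length xs ≤ n
  Unique-Fin⇒length≤ {n} {xs} u =
    subst (length xs ≤_) (length-tabulate {n = n} (λ i → i)) (Unique⇒length≤ u (λ {x} _ → ∈-allFin x))

  module _ (f : A → List B) where

    concatMap-owner : ∀ {xs x x′ y} → Unique (concatMap f xs) → x ∈ xs → x′ ∈ xs → y ∈ f x → y ∈ f x′ → x ≡ x′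
    concatMap-owner {_ ∷ xs} u (here refl) (here refl) _ _ = refl
    concatMap-owner {z ∷ xs} u (here refl) (there x′∈) y∈ y∈′ =
      ⊥-elim (proj₂ (proj₂ (Unique-++⁻ (f z) u)) y∈ (∈-concatMap⁺ f (lose x′∈ y∈′)))
    concatMap-owner {z ∷ xs} u (there x∈) (here refl) y∈ y∈′ =
      ⊥-elim (proj₂ (proj₂ (Unique-++⁻ (f z) u)) y∈′ (∈-concatMap⁺ f (lose x∈ y∈)))
    concatMap-owner {z ∷ xs} u (there x∈) (there x′∈) y∈ y∈′ =
      concatMap-owner (proj₁ (proj₂ (Unique-++⁻ (f z) u))) x∈ x′∈ y∈ y∈′

    Unique-concatMap⁻ : ∀ {xs x} → Unique (concatMap f xs) → x ∈ xs → Unique (f x)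
    Unique-concatMap⁻ {z ∷ xs} u (here refl) = proj₁ (Unique-++⁻ (f z) u)
    Unique-concatMap⁻ {z ∷ xs} u (there x∈) = Unique-concatMap⁻ (proj₁ (proj₂ (Unique-++⁻ (f z) u))) x∈

    Unique-concatMap-filter : ∀ {P : A → Set} (P? : ∀ x → Dec (P x)) xs →
      Unique (concatMap f xs) → Unique (concatMap f (filter P? xs))
    Unique-concatMap-filter P? []       u = u
    Unique-concatMap-filter P? (x ∷ xs) u with Unique-++⁻ (f x) u | P? x
    ... | ufx , urest , disj | no _  = Unique-concatMap-filter P? xs urest
    ... | ufx , urest , disj | yes _ = Unique-++⁺ ufx (Unique-concatMap-filter P? xs urest) λ y∈ y∈′ →
      let z , z∈ , y∈z = find (∈-concatMap⁻ f {xs = filter P? xs} y∈′)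
      in disj y∈ (∈-concatMap⁺ f (lose (proj₁ (∈-filter⁻ P? {xs = xs} z∈)) y∈z))

  -- Chains, consecutive pairs and cyclic order

  Linked-++⁻ˡ : ∀ xs → Linked R (xs ++ ys) → Linked R xs
  Linked-++⁻ˡ []           _       = []
  Linked-++⁻ˡ (x ∷ [])     _       = [-]
  Linked-++⁻ˡ (x ∷ y ∷ xs) (r ∷ c) = r ∷ Linked-++⁻ˡ (y ∷ xs) c

  Linked-++⁻ʳ : ∀ xs → Linked R (xs ++ ys) → Linked R ys
  Linked-++⁻ʳ []       c = c
  Linked-++⁻ʳ (x ∷ xs) c = Linked-++⁻ʳ xs (Linked.tail c)

  Linked-prefix : ∀ xs → Linked R (x ∷ xs ++ y ∷ ys) → Linked R (x ∷ xs ∷ʳ y)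
  Linked-prefix {x = x} {y = y} {ys = ys} xs c =
    Linked-++⁻ˡ (x ∷ xs ∷ʳ y) (subst (Linked _) (cong (x ∷_) (sym (++-assoc xs [ y ] ys))) c)

  Linked-join : ∀ xs → Linked R (xs ∷ʳ x) → Linked R (x ∷ ys) → Linked R (xs ++ x ∷ ys)
  Linked-join []           _       d = d
  Linked-join (y ∷ [])     (r ∷ _) d = r ∷ d
  Linked-join (y ∷ z ∷ xs) (r ∷ c) d = r ∷ Linked-join (z ∷ xs) c d

  Linked-∷ʳ : ∀ xs → Linked R (xs ∷ʳ y) → R y z → Linked R (xs ∷ʳ y ∷ʳ z)
  Linked-∷ʳ []           _        r = r ∷ [-]
  Linked-∷ʳ (x ∷ [])     (r′ ∷ _) r = r′ ∷ r ∷ [-]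
  Linked-∷ʳ (x ∷ x′ ∷ xs) (r′ ∷ c) r = r′ ∷ Linked-∷ʳ (x′ ∷ xs) c r

  Linked-reverse : (∀ {x y} → R x y → R y x) → Linked R xs → Linked R (reverse xs)
  Linked-reverse sym-R []  = []
  Linked-reverse sym-R [-] = [-]
  Linked-reverse {R = R} {xs = x ∷ y ∷ xs} sym-R (r ∷ c)
    rewrite unfold-reverse x (y ∷ xs) | unfold-reverse y xs =
    Linked-∷ʳ (reverse xs) (subst (Linked R) (unfold-reverse y xs) (Linked-reverse sym-R c)) (sym-R r)

  module _ {R : A → A → Set} {P : A → Set} (forth : ∀ {x y} → R x y → P x → P y) (back : ∀ {x y} → R x y → P y → P x) where

    Linked-transport : Linked R xs → x ∈ xs → y ∈ xs → P x → P y
    Linked-transport {xs = _ ∷ _} c x∈ y∈ px = fromHead c y∈ (toHead c x∈ px)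
      where
      toHead : ∀ {z zs x} → Linked R (z ∷ zs) → x ∈ z ∷ zs → P x → P z
      toHead c       (here refl) px = px
      toHead (r ∷ c) (there x∈)  px = back r (toHead c x∈ px)
      fromHead : ∀ {z zs x} → Linked R (z ∷ zs) → x ∈ z ∷ zs → P z → P x
      fromHead c       (here refl) pz = pz
      fromHead (r ∷ c) (there x∈)  pz = fromHead c x∈ (forth r pz)

  Consec-++⁺ˡ : Consec xs x y → Consec (xs ++ ys) x y
  Consec-++⁺ˡ here      = here
  Consec-++⁺ˡ (there p) = there (Consec-++⁺ˡ p)

  Consec-++⁺ʳ : ∀ xs → Consec ys x y → Consec (xs ++ ys) x y
  Consec-++⁺ʳ []       p = p
  Consec-++⁺ʳ (_ ∷ xs) p = there (Consec-++⁺ʳ xs p)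

  Consec-++⁻ : ∀ xs → Consec (xs ++ z ∷ ys) x y → Consec (xs ∷ʳ z) x y ⊎ Consec (z ∷ ys) x y
  Consec-++⁻ []            p         = inj₂ p
  Consec-++⁻ (_ ∷ [])      here      = inj₁ here
  Consec-++⁻ (_ ∷ [])      (there p) = inj₂ p
  Consec-++⁻ (_ ∷ _ ∷ _)   here      = inj₁ here
  Consec-++⁻ (_ ∷ x′ ∷ xs) (there p) = [ inj₁ ∘ there , inj₂ ]′ (Consec-++⁻ (x′ ∷ xs) p)

  Consec-∈ˡ : Consec xs x y → x ∈ xs
  Consec-∈ˡ here      = here refl
  Consec-∈ˡ (there p) = there (Consec-∈ˡ p)

  Consec-∈ʳ : Consec xs x y → y ∈ xs
  Consec-∈ʳ here      = there (here refl)
  Consec-∈ʳ (there p) = there (Consec-∈ʳ p)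

  Consec-∈-tail : Consec (z ∷ xs) x y → y ∈ xs
  Consec-∈-tail here      = here refl
  Consec-∈-tail (there p) = Consec-∈ʳ p

  Consec-∷ʳ-∈ˡ : ∀ xs → Consec (xs ∷ʳ z) x y → x ∈ xs
  Consec-∷ʳ-∈ˡ (_ ∷ [])     here      = here refl
  Consec-∷ʳ-∈ˡ (_ ∷ _ ∷ _)  here      = here refl
  Consec-∷ʳ-∈ˡ (_ ∷ x′ ∷ xs) (there p) = there (Consec-∷ʳ-∈ˡ (x′ ∷ xs) p)
  Consec-∷ʳ-∈ˡ []           (there ())
  Consec-∷ʳ-∈ˡ (_ ∷ [])     (there (there ()))

  Consec-last : ∀ xs → x ∉ xs ∷ʳ z → Consec ((xs ∷ʳ z) ∷ʳ x) y x → y ≡ z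
  Consec-last []           x∉ here              = refl
  Consec-last []           x∉ (there (there ()))
  Consec-last (_ ∷ [])     x∉ here              = ⊥-elim (x∉ (there (here refl)))
  Consec-last (_ ∷ _ ∷ _)  x∉ here              = ⊥-elim (x∉ (there (here refl)))
  Consec-last (_ ∷ xs)     x∉ (there p)         = Consec-last xs (x∉ ∘ there) p

  Consec-reverse : Consec xs x y → Consec (reverse xs) y x
  Consec-reverse {xs = x ∷ y ∷ xs} here
    rewrite unfold-reverse x (y ∷ xs) | unfold-reverse y xs =
    subst (λ l → Consec l y x) (sym (++-assoc (reverse xs) [ y ] [ x ])) (Consec-++⁺ʳ (reverse xs) here)
  Consec-reverse {xs = x ∷ xs} (there p)
    rewrite unfold-reverse x xs = Consec-++⁺ˡ (Consec-reverse p)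

  Consec⇒Linked : ∀ xs → (∀ {x y} → Consec xs x y → R x y) → Linked R xs
  Consec⇒Linked []           f = []
  Consec⇒Linked (x ∷ [])     f = [-]
  Consec⇒Linked (x ∷ y ∷ xs) f = f here ∷ Consec⇒Linked (y ∷ xs) (f ∘ there)

  Linked-Consec : Linked R xs → Consec xs x y → R x y
  Linked-Consec (r ∷ _) here      = r
  Linked-Consec (_ ∷ c) (there p) = Linked-Consec c p
  Linked-Consec [-]     (there ())

  module _ (_≟_ : ∀ (x y : A) → Dec (x ≡ y)) where

    Consec? : ∀ xs x y → Dec (Consec xs x y)
    Consec? []           x y = no λ ()
    Consec? (_ ∷ [])     x y = no λ { (there ()) }
    Consec? (a ∷ b ∷ xs) x y with a ≟ x | b ≟ y | Consec? (b ∷ xs) x y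
    ... | yes refl | yes refl | _     = yes here
    ... | _        | _        | yes p = yes (there p)
    ... | no a≢x   | _        | no ¬p = no λ { here → a≢x refl ; (there p) → ¬p p }
    ... | yes refl | no b≢y   | no ¬p = no λ { here → b≢y refl ; (there p) → ¬p p }

  pivot-cases : ∀ xs (x : A) ys us u vs → xs ++ x ∷ ys ≡ us ++ u ∷ vs →
    (xs ≡ us × x ≡ u × ys ≡ vs) ⊎
    (∃[ m ] (us ≡ xs ++ x ∷ m × ys ≡ m ++ u ∷ vs)) ⊎
    (∃[ m ] (xs ≡ us ++ u ∷ m × vs ≡ m ++ x ∷ ys))
  pivot-cases []       x ys []       u vs refl = inj₁ (refl , refl , refl)
  pivot-cases []       x ys (u′ ∷ us) u vs refl = inj₂ (inj₁ (us , refl , refl))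
  pivot-cases (x′ ∷ xs) x ys []       u vs refl = inj₂ (inj₂ (xs , refl , refl))
  pivot-cases (x′ ∷ xs) x ys (u′ ∷ us) u vs eq with ∷-injectiveˡ eq | pivot-cases xs x ys us u vs (∷-injectiveʳ eq)
  ... | refl | inj₁ (refl , x≡u , ys≡vs)          = inj₁ (refl , x≡u , ys≡vs)
  ... | refl | inj₂ (inj₁ (m , us≡ , ys≡))       = inj₂ (inj₁ (m , cong (x′ ∷_) us≡ , ys≡))
  ... | refl | inj₂ (inj₂ (m , xs≡ , vs≡))       = inj₂ (inj₂ (m , cong (x′ ∷_) xs≡ , vs≡))

  reverse-pivot : ∀ xs (y : A) ys → reverse (xs ++ y ∷ ys) ≡ reverse ys ++ y ∷ reverse xs
  reverse-pivot xs y ys =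
    trans (reverse-++ xs (y ∷ ys)) (trans (cong (_++ reverse xs) (unfold-reverse y ys)) (++-assoc (reverse ys) [ y ] (reverse xs)))

  3≤length-∷-++ : ∀ (x : A) xs y z zs → 3 ≤ length (x ∷ xs ++ y ∷ z ∷ zs)
  3≤length-∷-++ x xs y z zs = s≤s (subst (2 ≤_) (sym (length-++ xs)) (≤-trans (s≤s (s≤s z≤n)) (m≤n+m _ (length xs))))

  3≤length-closing : ∀ (x : A) y ys z → 3 ≤ length (x ∷ y ∷ ys ∷ʳ z)
  3≤length-closing x y ys z = s≤s (s≤s (subst (1 ≤_) (sym (length-++ ys)) (m≤n+m 1 (length ys))))

  Cyclic : List A → A → A → Set
  Cyclic []       x y = ⊥
  Cyclic (c ∷ cs) x y = Consec ((c ∷ cs) ∷ʳ c) x y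

  Consec⇒Cyclic : ∀ xs → Consec xs x y → Cyclic xs x y
  Consec⇒Cyclic (_ ∷ _) p = Consec-++⁺ˡ p

  Cyclic-∈ˡ : ∀ xs → Cyclic xs x y → x ∈ xs
  Cyclic-∈ˡ (c ∷ cs) p = Consec-∷ʳ-∈ˡ (c ∷ cs) p

  Cyclic-∈ʳ : ∀ xs → Cyclic xs x y → y ∈ xs
  Cyclic-∈ʳ (c ∷ cs) p with ∈-++⁻ cs (Consec-∈-tail p)
  ... | inj₁ y∈         = there y∈
  ... | inj₂ (here refl) = here refl

  Cyclic-closing : ∀ (x : A) xs y → Cyclic (x ∷ xs ∷ʳ y) y x
  Cyclic-closing x xs y = subst (λ l → Consec l y x) (sym (++-assoc (x ∷ xs) [ y ] [ x ])) (Consec-++⁺ʳ (x ∷ xs) here)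

  Closed : (A → A → Set) → List A → Set
  Closed R cs = ∀ {x y} → Cyclic cs x y → R x y

  Closed⇒Linked : Closed R (x ∷ xs) → Linked R ((x ∷ xs) ∷ʳ x)
  Closed⇒Linked {x = x} {xs = xs} cl = Consec⇒Linked ((x ∷ xs) ∷ʳ x) cl

  Linked⇒Closed : Linked R ((x ∷ xs) ∷ʳ x) → Closed R (x ∷ xs)
  Linked⇒Closed c = Linked-Consec c

  SameCycle : List A → List A → Set
  SameCycle cs ds = (∀ {x y} → Cyclic cs x y → Cyclic ds x y) × (∀ {x y} → Cyclic ds x y → Cyclic cs x y)

  SameCycle-sym : SameCycle xs ys → SameCycle ys xs
  SameCycle-sym (to , from) = from , to

  Cyclic-rotate : ∀ (c : A) as x bs → Cyclic (c ∷ as ++ x ∷ bs) y z → Cyclic (x ∷ bs ++ c ∷ as) y z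
  Cyclic-rotate {y = y} {z = z} c as x bs p
    with Consec-++⁻ (c ∷ as) (subst (λ l → Consec l y z) (cong (c ∷_) (++-assoc as (x ∷ bs) [ c ])) p)
  ... | inj₁ q = subst (λ l → Consec l y z) shape (Consec-++⁺ʳ (x ∷ bs) q)
    where shape = cong (x ∷_) (sym (++-assoc bs (c ∷ as) [ x ]))
  ... | inj₂ q = subst (λ l → Consec l y z) shape (Consec-++⁺ˡ {ys = as ∷ʳ x} q)
    where shape = trans (++-assoc (x ∷ bs) [ c ] (as ∷ʳ x)) (cong (x ∷_) (sym (++-assoc bs (c ∷ as) [ x ])))

  rotate : x ∈ xs → ∃[ ys ] ((x ∷ ys) ↭ xs × SameCycle xs (x ∷ ys))
  rotate x∈ with ∈-∃++ x∈
  ... | [] , bs , refl = bs , ↭-refl , (λ p → p) , (λ p → p)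
  ... | c ∷ as , bs , refl =
    bs ++ c ∷ as , ↭-sym (++-comm (c ∷ as) (_ ∷ bs)) , Cyclic-rotate c as _ bs , Cyclic-rotate _ bs c as

  Cyclic-reverse : ∀ (x : A) xs → Cyclic (x ∷ reverse xs) y z → Cyclic (x ∷ xs) z y
  Cyclic-reverse {y = y} {z = z} x xs p =
    subst (λ l → Consec l z y) (reverse-involutive ((x ∷ xs) ∷ʳ x)) (Consec-reverse (subst (λ l → Consec l y z) shape p))
    where
    shape : (x ∷ reverse xs) ∷ʳ x ≡ reverse ((x ∷ xs) ∷ʳ x)
    shape = sym (trans (reverse-++ (x ∷ xs) [ x ]) (cong (x ∷_) (unfold-reverse x xs)))

  Closed-reverse : Closed R (x ∷ xs) → Closed (λ a b → R b a) (x ∷ reverse xs)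
  Closed-reverse {x = x} {xs = xs} cl p = cl (Cyclic-reverse x xs p)

  CycleNeighbours : List A → A → Set
  CycleNeighbours xs x = ∃[ y ] ∃[ z ] (y ≢ z × Cyclic xs x y × Cyclic xs z x ×
    (∀ {w} → Cyclic xs x w → w ≡ y) × (∀ {w} → Cyclic xs w x → w ≡ z))

  head-neighbours : ∀ (x d : A) ds l → Unique (x ∷ d ∷ ds ∷ʳ l) → CycleNeighbours (x ∷ d ∷ ds ∷ʳ l) x
  head-neighbours x d ds l (x∉ ∷ d∉ ∷ _) =
    d , l , (λ d≡l → All.lookup d∉ (∈-++⁺ʳ ds (here refl)) d≡l) , here , predecessor , after , before
    where
    shape : (x ∷ d ∷ ds) ++ l ∷ x ∷ [] ≡ (x ∷ d ∷ ds ∷ʳ l) ∷ʳ x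
    shape = cong (λ t → x ∷ d ∷ t) (sym (++-assoc ds [ l ] [ x ]))
    predecessor : Cyclic (x ∷ d ∷ ds ∷ʳ l) l x
    predecessor = subst (λ t → Consec t l x) shape (Consec-++⁺ʳ (x ∷ d ∷ ds) here)
    x∉rest : x ∉ d ∷ ds ∷ʳ l
    x∉rest x∈ = All.lookup x∉ x∈ refl
    after : ∀ {w} → Cyclic (x ∷ d ∷ ds ∷ʳ l) x w → w ≡ d
    after here      = refl
    after (there p) = ⊥-elim (x∉rest (Consec-∷ʳ-∈ˡ (d ∷ ds ∷ʳ l) p))
    before : ∀ {w} → Cyclic (x ∷ d ∷ ds ∷ʳ l) w x → w ≡ l
    before here      = ⊥-elim (x∉rest (here refl))
    before (there p) = Consec-last (d ∷ ds) x∉rest p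

  CycleNeighbours-resp : SameCycle xs ys → CycleNeighbours xs x → CycleNeighbours ys x
  CycleNeighbours-resp (to , from) (y , z , y≢z , succ , pred , after , before) =
    y , z , y≢z , to succ , to pred , after ∘ from , before ∘ from

  cycle-neighbours : Unique xs → 3 ≤ length xs → x ∈ xs → CycleNeighbours xs x
  cycle-neighbours {xs = xs} {x = x} uniq len x∈ with rotate x∈
  ... | ys , perm , same = CycleNeighbours-resp (SameCycle-sym same)
    (rotated ys (Unique-↭ (↭-sym perm) uniq) (subst (3 ≤_) (sym (↭-length perm)) len))
    where
    rotated : ∀ ys → Unique (x ∷ ys) → 3 ≤ length (x ∷ ys) → CycleNeighbours (x ∷ ys) x
    rotated ys uniq len with initLast ys
    rotated _ uniq (s≤s ()) | []
    rotated _ uniq (s≤s (s≤s ())) | [] ∷ʳ′ l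
    rotated _ uniq len | (d ∷ ds) ∷ʳ′ l = head-neighbours x d ds l uniq

  -- Parity of lengths

  parityOf : List A → Parity
  parityOf xs = parity (length xs)

  parityOf-++ : ∀ (xs ys : List A) → parityOf (xs ++ ys) ≡ parityOf xs ℙ.+ parityOf ys
  parityOf-++ xs ys = trans (cong parity (length-++ xs)) (+-homo-+ (length xs) (length ys))

  parityOf-∷ : ∀ (x : A) xs → parityOf (x ∷ xs) ≡ parityOf xs ⁻¹
  parityOf-∷ x xs = sym (⁻¹-selfInverse (suc-homo-⁻¹ (length xs)))

  parityOf-∷ʳ : ∀ (xs : List A) x → parityOf (xs ∷ʳ x) ≡ parityOf xs ⁻¹
  parityOf-∷ʳ xs x = trans (cong parity (trans (length-++ xs) (+-comm (length xs) 1))) (parityOf-∷ x xs)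

  parityOf-∷-∷ʳ : ∀ (x : A) xs y → parityOf (x ∷ xs ∷ʳ y) ≡ parityOf xs
  parityOf-∷-∷ʳ x xs y = cong (parity ∘ suc) (trans (length-++ xs) (+-comm (length xs) 1))

  parityOf-↭ : xs ↭ ys → parityOf xs ≡ parityOf ys
  parityOf-↭ p = cong parity (↭-length p)

  parityOf-reverse : ∀ (xs : List A) → parityOf (reverse xs) ≡ parityOf xs
  parityOf-reverse xs = cong parity (length-reverse xs)

  parityOf-pivot : ∀ xs (y : A) ys → parityOf (xs ++ y ∷ ys) ≡ parityOf xs ℙ.+ parityOf ys ⁻¹
  parityOf-pivot xs y ys = trans (parityOf-++ xs (y ∷ ys)) (cong (parityOf xs ℙ.+_) (parityOf-∷ y ys))

  parityOf-pivot-even : ∀ xs (y : A) ys → parityOf (xs ++ y ∷ ys) ≡ 0ℙ → parityOf xs ≡ parityOf ys ⁻¹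
  parityOf-pivot-even xs y ys e = +-cancelʳ-≡ (parityOf ys ⁻¹) (parityOf xs) (parityOf ys ⁻¹)
    (trans (trans (sym (parityOf-pivot xs y ys)) e) (sym (p+p≡0ℙ (parityOf ys ⁻¹))))

  parityOf-pivot-odd : ∀ xs (y : A) ys → parityOf (xs ++ y ∷ ys) ≡ 1ℙ → parityOf xs ≡ parityOf ys
  parityOf-pivot-odd xs y ys e = +-cancelʳ-≡ (parityOf ys ⁻¹) (parityOf xs) (parityOf ys)
    (trans (trans (sym (parityOf-pivot xs y ys)) e) (sym (p+p⁻¹≡1ℙ (parityOf ys))))

  parityOf-∷-pivot-even : ∀ (x : A) xs y ys → parityOf (x ∷ xs ++ y ∷ ys) ≡ 0ℙ → parityOf ys ≡ parityOf xs
  parityOf-∷-pivot-even x xs y ys e = ⁻¹-injective (trans (sym (parityOf-pivot-even (x ∷ xs) y ys e)) (parityOf-∷ x xs))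

  parity≡1ℙ⇒%2≡1 : ∀ n → parity n ≡ 1ℙ → n % 2 ≡ 1
  parity≡1ℙ⇒%2≡1 1             _ = refl
  parity≡1ℙ⇒%2≡1 (suc (suc n)) p = parity≡1ℙ⇒%2≡1 n p

  %2≡1⇒parity≡1ℙ : ∀ n → n % 2 ≡ 1 → parity n ≡ 1ℙ
  %2≡1⇒parity≡1ℙ 1             _ = refl
  %2≡1⇒parity≡1ℙ (suc (suc n)) e = %2≡1⇒parity≡1ℙ n e

  module _ (R : A → A → Set) (R-sym : ∀ {x y} → R x y → R y x)
           (R-functional : ∀ {x y z} → R x y → R x z → y ≡ z) (R-irrefl : ∀ {x y} → R x y → x ≢ y) where

    matched⇒even : ∀ xs → Unique xs → (∀ {x} → x ∈ xs → ∃[ y ] (y ∈ xs × R x y)) → parityOf xs ≡ 0ℙ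
    matched⇒even xs = go (length xs) xs ≤-refl
      where
      go : ∀ k xs → length xs ≤ k → Unique xs → (∀ {x} → x ∈ xs → ∃[ y ] (y ∈ xs × R x y)) → parityOf xs ≡ 0ℙ
      go k       []       _  _         _       = refl
      go zero    (x ∷ xs) ()
      go (suc k) (x ∷ xs) lk (x∉ ∷ u) matched with matched (here refl)
      ... | y , here refl , rxy = ⊥-elim (R-irrefl rxy refl)
      ... | y , there y∈ , rxy with ∈-∃++ y∈
      ... | as , bs , refl = subst (λ m → parity (suc m) ≡ 0ℙ) (sym (length-delete as)) ih
        where
        y∉ : y ∉ as ++ bs
        y∉ with Unique-↭ (shift y as bs) u
        ... | y∉all ∷ _ = λ y∈′ → All.lookup y∉all y∈′ refl
        matched′ : ∀ {z} → z ∈ as ++ bs → ∃[ w ] (w ∈ as ++ bs × R z w)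
        matched′ {z} z∈ with matched (there (∈-undelete as z∈))
        ... | w , here refl , rzw = ⊥-elim (y∉ (subst (_∈ as ++ bs) (R-functional (R-sym rzw) rxy) z∈))
        ... | w , there w∈ , rzw =
          w , ∈-delete as w∈ (λ { refl → All.lookup x∉ (∈-undelete as z∈) (sym (R-functional (R-sym rzw) (R-sym rxy))) }) , rzw
        ih : parity (suc (suc (length (as ++ bs)))) ≡ 0ℙ
        ih = go k (as ++ bs) (≤-trans (n≤1+n _) (subst (_≤ k) (length-delete as) (≤-pred lk))) (Unique-delete as u) matched′

module Sachs {n : ℕ} (G : Graph n) where

  open import Data.List.Membership.DecPropositional (_≟_ {n}) using (_∈?_)

  V : Set
  V = Fin n

  private variable
    u v w x y z : V
    S : VSet n
    p : Piece n
    ps qs new : List (Piece n)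
    xs ys Y Z : List V

  Adj : V → V → Set
  Adj x y = adj G x y ≡ true

  Adj-sym : Adj x y → Adj y x
  Adj-sym {x} {y} e = trans (symm G y x) e

  Adj-irrefl : Adj x y → x ≢ y
  Adj-irrefl {x} e refl = case trans (sym e) (irrefl G x) of λ ()

  vertices : List (Piece n) → List V
  vertices = concatMap verts

  Edge : List (Piece n) → V → V → Set
  Edge ps u v = Any (λ p → PieceEdge p u v) ps

  CycEdge⇒Cyclic : ∀ cs → CycEdge cs u v → Cyclic cs u v ⊎ Cyclic cs v u
  CycEdge⇒Cyclic (_ ∷ _) e = e

  Cyclic⇒CycEdge : ∀ cs → Cyclic cs u v ⊎ Cyclic cs v u → CycEdge cs u v
  Cyclic⇒CycEdge []      (inj₁ ())
  Cyclic⇒CycEdge []      (inj₂ ())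
  Cyclic⇒CycEdge (_ ∷ _) e = e

  Closed⇒CycEdge-Adj : ∀ cs → Closed Adj cs → CycEdge cs u v → Adj u v
  Closed⇒CycEdge-Adj cs cl e = [ cl , Adj-sym ∘ cl ]′ (CycEdge⇒Cyclic cs e)

  PieceEdge-sym : ∀ p → PieceEdge p u v → PieceEdge p v u
  PieceEdge-sym (k2 _ _)   (inj₁ (e₁ , e₂)) = inj₂ (e₂ , e₁)
  PieceEdge-sym (k2 _ _)   (inj₂ (e₁ , e₂)) = inj₁ (e₂ , e₁)
  PieceEdge-sym (cycle cs) e = Cyclic⇒CycEdge cs ([ inj₂ , inj₁ ]′ (CycEdge⇒Cyclic cs e))

  PieceEdge-∈ˡ : ∀ p → PieceEdge p u v → u ∈ verts p
  PieceEdge-∈ˡ (k2 _ _)   (inj₁ (refl , _)) = here refl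
  PieceEdge-∈ˡ (k2 _ _)   (inj₂ (refl , _)) = there (here refl)
  PieceEdge-∈ˡ (cycle cs) e = [ Cyclic-∈ˡ cs , Cyclic-∈ʳ cs ]′ (CycEdge⇒Cyclic cs e)

  PieceEdge-∈ʳ : ∀ p → PieceEdge p u v → v ∈ verts p
  PieceEdge-∈ʳ p = PieceEdge-∈ˡ p ∘ PieceEdge-sym p

  Edge-sym : Edge ps u v → Edge ps v u
  Edge-sym = Any.map (λ {p} → PieceEdge-sym p)

  Edge-∈ˡ : Edge ps u v → u ∈ vertices ps
  Edge-∈ˡ e = let p , p∈ , pe = find e in ∈-concatMap⁺ verts (lose p∈ (PieceEdge-∈ˡ p pe))

  Edge-∈ʳ : Edge ps u v → v ∈ vertices ps
  Edge-∈ʳ = Edge-∈ˡ ∘ Edge-sym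

  record IsSachsFamily (S : VSet n) (ps : List (Piece n)) : Set where
    field
      wellFormed : All WfPiece ps
      disjoint   : Unique (vertices ps)
      covers     : S x ≡ true → x ∈ vertices ps
      inside     : x ∈ vertices ps → S x ≡ true
      adjacent   : Edge ps u v → Adj u v

  SachsUnique : VSet n → Set
  SachsUnique S = ∀ {ps qs} → IsSachsFamily S ps → IsSachsFamily S qs → ∀ {u v} → Edge ps u v → Edge qs u v

  Matched : List (Piece n) → V → V → Set
  Matched ps x y = k2 x y ∈ ps ⊎ k2 y x ∈ ps

  Matched-sym : Matched ps x y → Matched ps y x
  Matched-sym = [ inj₂ , inj₁ ]′

  Matched⇒Edge : Matched ps x y → Edge ps x y
  Matched⇒Edge (inj₁ m) = lose m (inj₁ (refl , refl))
  Matched⇒Edge (inj₂ m) = lose m (inj₂ (refl , refl))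

  Matched-only : Unique (vertices ps) → Matched ps x y → Edge ps x z → z ≡ y
  Matched-only {ps} {x} u mxy e with find e | mxy
  ... | q , q∈ , qe | inj₁ m with concatMap-owner verts u m q∈ (here refl) (PieceEdge-∈ˡ q qe) | qe
  ...   | refl | inj₁ (_ , z≡y)    = z≡y
  ...   | refl | inj₂ (x≡y , z≡x) = trans z≡x x≡y
  Matched-only {ps} {x} u mxy e | q , q∈ , qe | inj₂ m with concatMap-owner verts u m q∈ (there (here refl)) (PieceEdge-∈ˡ q qe) | qe
  ...   | refl | inj₁ (x≡y , z≡x) = trans z≡x x≡y
  ...   | refl | inj₂ (_ , z≡y)    = z≡y

  OnCycle : List (Piece n) → V → Set
  OnCycle ps x = ∃[ cs ] (cycle cs ∈ ps × x ∈ cs)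

  matched-or-on-cycle : x ∈ vertices ps → (∃[ y ] Matched ps x y) ⊎ OnCycle ps x
  matched-or-on-cycle {ps = ps} x∈ with find (∈-concatMap⁻ verts {xs = ps} x∈)
  ... | k2 _ y   , m , here refl         = inj₁ (y , inj₁ m)
  ... | k2 y _   , m , there (here refl) = inj₁ (y , inj₂ m)
  ... | cycle cs , m , x∈cs              = inj₂ (cs , m , x∈cs)

  Matched⇒¬OnCycle : Unique (vertices ps) → Matched ps x y → ¬ OnCycle ps x
  Matched⇒¬OnCycle disj (inj₁ m) (_ , mC , x∈C) with concatMap-owner verts disj m mC (here refl) x∈C
  ... | ()
  Matched⇒¬OnCycle disj (inj₂ m) (_ , mC , x∈C) with concatMap-owner verts disj m mC (there (here refl)) x∈C
  ... | ()

  Saturated : List (Piece n) → List V → Set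
  Saturated ps Y = ∀ {p x y} → p ∈ ps → x ∈ verts p → y ∈ verts p → x ∈ Y → y ∈ Y

  Saturated-++ : Saturated ps Y → Saturated ps Z → Saturated ps (Y ++ Z)
  Saturated-++ {Y = Y} satY satZ p∈ x∈ y∈ x∈YZ =
    [ ∈-++⁺ˡ ∘ satY p∈ x∈ y∈ , ∈-++⁺ʳ Y ∘ satZ p∈ x∈ y∈ ]′ (∈-++⁻ Y x∈YZ)

  record SachsFamilyOn (Y : List V) (ps : List (Piece n)) : Set where
    field
      wellFormed : All WfPiece ps
      spans      : vertices ps ↭ Y
      adjacent   : Edge ps u v → Adj u v

  SachsFamilyOn-++ : SachsFamilyOn Y ps → SachsFamilyOn Z qs → SachsFamilyOn (Y ++ Z) (ps ++ qs)
  SachsFamilyOn-++ {ps = ps} {qs = qs} f g = record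
    { wellFormed = All.++⁺ (SachsFamilyOn.wellFormed f) (SachsFamilyOn.wellFormed g)
    ; spans      = subst (_↭ _) (sym (concatMap-++ verts ps qs)) (++⁺ (SachsFamilyOn.spans f) (SachsFamilyOn.spans g))
    ; adjacent   = [ SachsFamilyOn.adjacent f , SachsFamilyOn.adjacent g ]′ ∘ Any.++⁻ ps
    }

  SachsFamilyOn-↭ : Y ↭ Z → SachsFamilyOn Y ps → SachsFamilyOn Z ps
  SachsFamilyOn-↭ Y↭Z f = record
    { wellFormed = SachsFamilyOn.wellFormed f
    ; spans      = ↭-trans (SachsFamilyOn.spans f) Y↭Z
    ; adjacent   = SachsFamilyOn.adjacent f
    }

  untouched : List V → List (Piece n) → List (Piece n)
  untouched Y = filter (λ p → ¬? (Any.any? (_∈? Y) (verts p)))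

  pairs : List V → List (Piece n)
  pairs (x ∷ y ∷ xs) = k2 x y ∷ pairs xs
  pairs _            = []

  vertices-pairs : ∀ xs → parityOf xs ≡ 0ℙ → vertices (pairs xs) ≡ xs
  vertices-pairs []           _ = refl
  vertices-pairs (x ∷ y ∷ xs) e = cong (λ t → x ∷ y ∷ t) (vertices-pairs xs e)

  pairs-wellFormed : ∀ xs → All WfPiece (pairs xs)
  pairs-wellFormed []           = []
  pairs-wellFormed (_ ∷ [])     = []
  pairs-wellFormed (_ ∷ _ ∷ xs) = tt ∷ pairs-wellFormed xs

  pairs-Adj : Linked Adj xs → Edge (pairs xs) u v → Adj u v
  pairs-Adj (r ∷ _)      (here (inj₁ (refl , refl))) = r
  pairs-Adj (r ∷ _)      (here (inj₂ (refl , refl))) = Adj-sym r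
  pairs-Adj (_ ∷ [-])    (there ())
  pairs-Adj (_ ∷ _ ∷ c)  (there e) = pairs-Adj c e

  pairs-family : parityOf xs ≡ 0ℙ → Linked Adj xs → SachsFamilyOn xs (pairs xs)
  pairs-family {xs} even c = record
    { wellFormed = pairs-wellFormed xs
    ; spans      = ↭-reflexive (vertices-pairs xs even)
    ; adjacent   = pairs-Adj c
    }

  cycle-family : 3 ≤ length xs → Closed Adj xs → SachsFamilyOn xs [ cycle xs ]
  cycle-family {xs} len cl = record
    { wellFormed = len ∷ []
    ; spans      = ↭-reflexive (++-identityʳ xs)
    ; adjacent   = λ { (here e) → Closed⇒CycEdge-Adj xs cl e }
    }

  module _ {S′ : VSet n} (sf : IsSachsFamily S ps) (satY : Saturated ps Y)
           (shrink : ∀ {x} → S′ x ≡ true → S x ≡ true × x ∉ Y)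
           (keep : ∀ {x} → S x ≡ true → x ∉ Y → S′ x ≡ true) where

    private
      keep? = λ p → ¬? (Any.any? (_∈? Y) (verts p))
      kept⁻ : p ∈ untouched Y ps → p ∈ ps × ¬ Any (_∈ Y) (verts p)
      kept⁻ p∈ = ∈-filter⁻ keep? {xs = ps} p∈

    untouched-Edge : Edge (untouched Y ps) u v → Edge ps u v
    untouched-Edge e = let p , p∈ , pe = find e in lose (proj₁ (kept⁻ p∈)) pe

    restrict : IsSachsFamily S′ (untouched Y ps)
    restrict = record
      { wellFormed = All.tabulate (All.lookup (IsSachsFamily.wellFormed sf) ∘ proj₁ ∘ kept⁻)
      ; disjoint   = Unique-concatMap-filter verts keep? ps (IsSachsFamily.disjoint sf)
      ; covers     = covers
      ; inside     = inside
      ; adjacent   = IsSachsFamily.adjacent sf ∘ untouched-Edge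
      }
      where
      covers : S′ x ≡ true → x ∈ vertices (untouched Y ps)
      covers S′x with find (∈-concatMap⁻ verts {xs = ps} (IsSachsFamily.covers sf (proj₁ (shrink S′x))))
      ... | p , p∈ , x∈p with Any.any? (_∈? Y) (verts p)
      ...   | yes meets = let y , y∈p , y∈Y = find meets in ⊥-elim (proj₂ (shrink S′x) (satY p∈ y∈p x∈p y∈Y))
      ...   | no misses = ∈-concatMap⁺ verts (lose (∈-filter⁺ keep? p∈ misses) x∈p)
      inside : x ∈ vertices (untouched Y ps) → S′ x ≡ true
      inside x∈ with find (∈-concatMap⁻ verts {xs = untouched Y ps} x∈)
      ... | p , p∈ , x∈p = keep (IsSachsFamily.inside sf (∈-concatMap⁺ verts (lose (proj₁ (kept⁻ p∈)) x∈p)))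
                                (λ x∈Y → proj₂ (kept⁻ p∈) (lose x∈p x∈Y))

    Edge-untouched : Edge ps u v → (∃[ p ] (p ∈ ps × Any (_∈ Y) (verts p) × PieceEdge p u v)) ⊎ Edge (untouched Y ps) u v
    Edge-untouched e with find e
    ... | p , p∈ , pe with Any.any? (_∈? Y) (verts p)
    ...   | yes meets = inj₁ (p , p∈ , meets , pe)
    ...   | no misses = inj₂ (lose (∈-filter⁺ keep? p∈ misses) pe)

  _∖_ : VSet n → List V → VSet n
  (S ∖ Y) x = S x ∧ not (does (x ∈? Y))

  ∖⁻ : (S ∖ Y) x ≡ true → S x ≡ true × x ∉ Y
  ∖⁻ {S} {Y} {x} e with S x | x ∈? Y | e
  ... | true | no x∉ | _ = refl , x∉

  ∖⁺ : S x ≡ true → x ∉ Y → (S ∖ Y) x ≡ true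
  ∖⁺ {S} {x} {Y} Sx x∉ with S x | x ∈? Y
  ... | true | no _   = refl
  ... | true | yes x∈ = ⊥-elim (x∉ x∈)

  IsSachsFamily-join : SachsFamilyOn Y new → Unique Y → (∀ {x} → x ∈ Y → S x ≡ true) →
                       IsSachsFamily (S ∖ Y) ps → IsSachsFamily S (new ++ ps)
  IsSachsFamily-join {Y} {new} {S} {ps} fam uniqY Y⊆S sf = record
    { wellFormed = All.++⁺ (SachsFamilyOn.wellFormed fam) (IsSachsFamily.wellFormed sf)
    ; disjoint   = subst Unique (sym (concatMap-++ verts new ps))
                     (Unique-++⁺ (Unique-↭ (↭-sym (SachsFamilyOn.spans fam)) uniqY) (IsSachsFamily.disjoint sf)
                                 λ x∈new x∈ps → proj₂ (∖⁻ {S = S} {Y} (IsSachsFamily.inside sf x∈ps)) (fromNew x∈new))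
    ; covers     = covers
    ; inside     = inside
    ; adjacent   = [ SachsFamilyOn.adjacent fam , IsSachsFamily.adjacent sf ]′ ∘ Any.++⁻ new
    }
    where
    fromNew : x ∈ vertices new → x ∈ Y
    fromNew = ∈-resp-↭ (SachsFamilyOn.spans fam)
    covers : S x ≡ true → x ∈ vertices (new ++ ps)
    covers {x} Sx = subst (x ∈_) (sym (concatMap-++ verts new ps)) (case x ∈? Y of λ
      { (yes x∈Y) → ∈-++⁺ˡ (∈-resp-↭ (↭-sym (SachsFamilyOn.spans fam)) x∈Y)
      ; (no x∉Y)  → ∈-++⁺ʳ (vertices new) (IsSachsFamily.covers sf (∖⁺ {S = S} {Y = Y} Sx x∉Y)) })
    inside : x ∈ vertices (new ++ ps) → S x ≡ true
    inside {x} x∈ = [ Y⊆S ∘ fromNew , proj₁ ∘ ∖⁻ {S = S} {Y} ∘ IsSachsFamily.inside sf ]′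
                      (∈-++⁻ (vertices new) (subst (x ∈_) (concatMap-++ verts new ps) x∈))

  rearrange : IsSachsFamily S ps → (∀ {x} → x ∈ Y → S x ≡ true) → Saturated ps Y → Unique Y →
              SachsFamilyOn Y new → IsSachsFamily S (new ++ untouched Y ps)
  rearrange {S} {ps} {Y} sf Y⊆S satY uniqY fam =
    IsSachsFamily-join fam uniqY Y⊆S (restrict sf satY (∖⁻ {S = S} {Y}) (∖⁺ {S = S} {Y = Y}))

  PieceEdge? : ∀ (p : Piece n) u v → Dec (PieceEdge p u v)
  PieceEdge? (k2 a b)       u v = ((u ≟ a) ×-dec (v ≟ b)) ⊎-dec ((u ≟ b) ×-dec (v ≟ a))
  PieceEdge? (cycle [])     u v = no λ ()
  PieceEdge? (cycle (c ∷ cs)) u v = Consec? _≟_ ((c ∷ cs) ∷ʳ c) u v ⊎-dec Consec? _≟_ ((c ∷ cs) ∷ʳ c) v u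

  Edge? : ∀ (ps : List (Piece n)) u v → Dec (Edge ps u v)
  Edge? ps u v = Any.any? (λ p → PieceEdge? p u v) ps

  induced⁺ : Adj u v → S u ≡ true → S v ≡ true → induced G S u v ≡ true
  induced⁺ uv Su Sv rewrite uv | Su | Sv = refl

  induced⁻ : induced G S u v ≡ true → Adj u v × S u ≡ true × S v ≡ true
  induced⁻ {S = S} {u = u} {v = v} e with adj G u v | S u | S v | e
  ... | true | true | true | _ = refl , refl , refl

  induced-sym : induced G S u v ≡ true → induced G S v u ≡ true
  induced-sym {S = S} e with induced⁻ {S = S} e
  ... | uv , Su , Sv = induced⁺ (Adj-sym uv) Sv Su

  Edge⇒induced : IsSachsFamily S ps → Edge ps u v → induced G S u v ≡ true
  Edge⇒induced sf e = induced⁺ (IsSachsFamily.adjacent sf e) (IsSachsFamily.inside sf (Edge-∈ˡ e)) (IsSachsFamily.inside sf (Edge-∈ʳ e))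

  Matched-piece : Unique (vertices ps) → Matched ps u v → p ∈ ps → Any (_∈ u ∷ v ∷ []) (verts p) →
                  PieceEdge p x y → PieceEdge (k2 u v) x y
  Matched-piece {ps} {u} {v} {p} disj m p∈ meets pe with find meets
  ... | w , w∈p , w∈uv with m
  ...   | inj₁ m′ = subst (λ q → PieceEdge q _ _) (concatMap-owner verts disj p∈ m′ w∈p w∈uv) pe
  ...   | inj₂ m′ = PieceEdge-swap (subst (λ q → PieceEdge q _ _) (concatMap-owner verts disj p∈ m′ w∈p (swapped w∈uv)) pe)
    where
    swapped : w ∈ u ∷ v ∷ [] → w ∈ v ∷ u ∷ []
    swapped (here e)         = there (here e)
    swapped (there (here e)) = here e
    PieceEdge-swap : PieceEdge (k2 v u) x y → PieceEdge (k2 u v) x y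
    PieceEdge-swap = [ inj₂ , inj₁ ]′

  Matched-PieceEdge : Matched ps u v → PieceEdge (k2 u v) x y → Edge ps x y
  Matched-PieceEdge m (inj₁ (refl , refl)) = Matched⇒Edge m
  Matched-PieceEdge m (inj₂ (refl , refl)) = Edge-sym (Matched⇒Edge m)


module Rigidity {n : ℕ} (G : Graph n) where

  open Sachs G
  open import Data.List.Membership.DecPropositional (_≟_ {n}) using (_∈?_)
  open import Algebra.Solver.CommutativeMonoid (++-commutativeMonoid {A = V}) using (solve; _⊜_; _⊕_)

  private variable
    u v w x y z : V
    S : VSet n
    p : Piece n
    ps new : List (Piece n)
    xs ys Y Z Q D cs : List V

  record Block (S : VSet n) (ps : List (Piece n)) (Y : List V) : Set where
    field
      inS       : x ∈ Y → S x ≡ true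
      saturated : Saturated ps Y
      unique    : Unique Y

  Block-++ : Block S ps Y → Block S ps Z → (∀ {x} → x ∈ Y → x ∉ Z) → Block S ps (Y ++ Z)
  Block-++ {Y = Y} bY bZ apart = record
    { inS       = [ Block.inS bY , Block.inS bZ ]′ ∘ ∈-++⁻ Y
    ; saturated = Saturated-++ (Block.saturated bY) (Block.saturated bZ)
    ; unique    = Unique-++⁺ (Block.unique bY) (Block.unique bZ) apart
    }

  Block-[] : Block S ps []
  Block-[] = record { inS = λ () ; saturated = λ _ _ _ () ; unique = [] }

  Block-↭ : Y ↭ Z → Block S ps Y → Block S ps Z
  Block-↭ Y↭Z b = record
    { inS       = Block.inS b ∘ ∈-resp-↭ (↭-sym Y↭Z)
    ; saturated = λ p∈ x∈ y∈ → ∈-resp-↭ Y↭Z ∘ Block.saturated b p∈ x∈ y∈ ∘ ∈-resp-↭ (↭-sym Y↭Z)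
    ; unique    = Unique-↭ Y↭Z (Block.unique b)
    }

  headOr : V → List V → V
  headOr z []      = z
  headOr z (q ∷ _) = q

  Consec-headOr : ∀ Q {ys} → Consec (y ∷ Q ++ z ∷ ys) y (headOr z Q)
  Consec-headOr []      = here
  Consec-headOr (_ ∷ _) = here

  module _ {S : VSet n} {ps : List (Piece n)} (sf : IsSachsFamily S ps) where

    open IsSachsFamily sf

    piece-Adj : p ∈ ps → PieceEdge p u v → Adj u v
    piece-Adj p∈ e = adjacent (lose p∈ e)

    piece-inS : p ∈ ps → x ∈ verts p → S x ≡ true
    piece-inS p∈ x∈ = inside (∈-concatMap⁺ verts (lose p∈ x∈))

    piece-block : p ∈ ps → Block S ps (verts p)
    piece-block p∈ = record
      { inS       = piece-inS p∈
      ; saturated = λ q∈ x∈ y∈ x∈p → subst (λ q → _ ∈ verts q) (concatMap-owner verts disjoint q∈ p∈ x∈ x∈p) y∈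
      ; unique    = Unique-concatMap⁻ verts disjoint p∈
      }

    piece-block-++ : p ∈ ps → x ∈ verts p → x ∉ Y → Block S ps Y → Block S ps (verts p ++ Y)
    piece-block-++ p∈ x∈ x∉ bY = Block-++ (piece-block p∈) bY λ y∈ y∈Y → x∉ (Block.saturated bY p∈ y∈ x∈ y∈Y)

    matched-block : Matched ps x y → Block S ps (x ∷ y ∷ [])
    matched-block (inj₁ m) = piece-block m
    matched-block (inj₂ m) = Block-↭ (swap _ _ ↭-refl) (piece-block m)

    cycle-Closed : cycle cs ∈ ps → Closed Adj cs
    cycle-Closed {cs} c∈ e = piece-Adj c∈ (Cyclic⇒CycEdge cs (inj₁ e))

    Rooted : V → List V → List V → Set
    Rooted y cs D = (y ∷ D) ↭ cs × Closed Adj (y ∷ D)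

    root : cycle cs ∈ ps → y ∈ cs → ∃[ D ] Rooted y cs D
    root c∈ y∈ with rotate y∈
    ... | D , perm , _ , back = D , perm , cycle-Closed c∈ ∘ back

    Rooted-reverse : Rooted y cs D → Rooted y cs (reverse D)
    Rooted-reverse {y} {D = D} (perm , cl) = ↭-trans (prep y (↭-reverse D)) perm , Adj-sym ∘ Closed-reverse cl

    Rooted-walk : Rooted y cs D → Linked Adj ((y ∷ D) ∷ʳ y)
    Rooted-walk (_ , cl) = Closed⇒Linked cl

    Rooted-inner : Rooted y cs D → Linked Adj D
    Rooted-inner {D = D} r = Linked-++⁻ˡ D (Linked.tail (Rooted-walk r))

    -- Re-covering the cycles through y and z together with Q turns the walk into a cycle (when y and z lie
    -- on one cycle) or pairs it up (otherwise), so a family-free first edge contradicts uniqueness.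
    record Bridge (y z : V) (Q : List V) : Set where
      field
        block : Block S ps Q
        even  : parityOf Q ≡ 0ℙ
        y∉    : y ∉ Q
        z∉    : z ∉ Q
        walk  : Linked Adj (y ∷ Q ∷ʳ z)
        fresh : ¬ Edge ps y (headOr z Q)

    module _ (unique : SachsUnique S) where

      rearranged : Block S ps Y → SachsFamilyOn Y new → IsSachsFamily S (new ++ untouched Y ps)
      rearranged b = rearrange sf (Block.inS b) (Block.saturated b) (Block.unique b)

      rearranged-edge : Block S ps Y → SachsFamilyOn Y new → Edge new u v → Edge ps u v
      rearranged-edge b fam e = unique (rearranged b fam) sf (Any.++⁺ˡ e)

      -- An even cycle c₀ c₁ c₂ … could be traded for the matching c₀c₁, c₂c₃, …, which misses c₁c₂.
      cycle-odd : cycle cs ∈ ps → parityOf cs ≡ 1ℙ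
      cycle-odd {cs} c∈ with parityOf cs in even
      ... | 1ℙ = refl
      ... | 0ℙ = ⊥-elim (even-cycle cs (All.lookup wellFormed c∈) even c∈)
        where
        even-cycle : ∀ cs → 3 ≤ length cs → parityOf cs ≡ 0ℙ → cycle cs ∈ ps → ⊥
        even-cycle (_ ∷ _ ∷ []) (s≤s (s≤s ()))
        even-cycle (c₀ ∷ c₁ ∷ c₂ ∷ cs) _ even c∈ =
          c₂≢c₀ (Matched-only (IsSachsFamily.disjoint sf′) (inj₂ (Any.++⁺ˡ {ys = untouched L ps} (here refl))) c₁c₂)
          where
          L = c₀ ∷ c₁ ∷ c₂ ∷ cs
          sf′ = rearranged (piece-block c∈)
                  (pairs-family even (Linked-++⁻ˡ L (Closed⇒Linked {xs = c₁ ∷ c₂ ∷ cs} (cycle-Closed c∈))))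
          c₁c₂ : Edge (pairs L ++ untouched L ps) c₁ c₂
          c₁c₂ = unique sf sf′ (lose c∈ (inj₁ (there here)))
          c₂≢c₀ : c₂ ≢ c₀
          c₂≢c₀ with Block.unique (piece-block c∈)
          ... | c₀∉ ∷ _ = λ eq → All.lookup c₀∉ (there (here refl)) (sym eq)

      Rooted-even : cycle cs ∈ ps → Rooted y cs D → parityOf D ≡ 0ℙ
      Rooted-even {y = y} {D = D} c∈ (perm , _) =
        ⁻¹-injective (trans (sym (parityOf-∷ y D)) (trans (parityOf-↭ perm) (cycle-odd c∈)))

      ¬loop-bridge : cycle cs ∈ ps → y ∈ cs → Bridge y y Q → ⊥
      ¬loop-bridge {Q = []}          _   _  br with Bridge.walk br
      ... | r ∷ _ = Adj-irrefl r refl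
      ¬loop-bridge {Q = _ ∷ []}      _   _  br with Bridge.even br
      ... | ()
      ¬loop-bridge {cs} {y} {Q = Q@(_ ∷ _ ∷ _)} c∈ y∈ br =
        Bridge.fresh br (rearranged-edge (piece-block-++ c∈ y∈ (Bridge.y∉ br) (Bridge.block br)) family (here (inj₁ here)))
        where
        Dy = proj₁ (root c∈ y∈)
        rooted = proj₂ (root c∈ y∈)
        family : SachsFamilyOn (cs ++ Q) (cycle (y ∷ Q) ∷ pairs Dy)
        family = SachsFamilyOn-↭
          (↭-trans (solve 3 (λ y q d → (y ⊕ q) ⊕ d ⊜ (y ⊕ d) ⊕ q) ↭-refl [ y ] Q Dy) (++⁺ʳ Q (proj₁ rooted)))
          (SachsFamilyOn-++ (cycle-family (s≤s (s≤s (s≤s z≤n))) (Linked⇒Closed {xs = Q} (Bridge.walk br)))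
                            (pairs-family (Rooted-even c∈ rooted) (Rooted-inner rooted)))

      ¬chord-bridge : ∀ {D₁ D₂} → cycle cs ∈ ps → Rooted y cs (D₁ ++ z ∷ D₂) →
        parityOf D₁ ≡ 0ℙ → parityOf D₂ ≡ 1ℙ → Bridge y z Q → ⊥
      ¬chord-bridge {D₂ = []} _ _ _ () _
      ¬chord-bridge {cs} {y} {z} {Q} {D₁} {D₂@(d ∷ D₂′)} c∈ rooted evenD₁ _ br =
        Bridge.fresh br (rearranged-edge block family (here (inj₁ (subst (λ l → Consec l y (headOr z Q)) shape (Consec-headOr Q)))))
        where
        C = y ∷ Q ++ z ∷ D₂
        shape : y ∷ Q ++ z ∷ D₂ ∷ʳ y ≡ C ∷ʳ y
        shape = cong (y ∷_) (sym (++-assoc Q (z ∷ D₂) [ y ]))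
        closing : Linked Adj (z ∷ D₂ ∷ʳ y)
        closing = Linked-++⁻ʳ (y ∷ D₁) (subst (Linked Adj) (cong (y ∷_) (++-assoc D₁ (z ∷ D₂) [ y ])) (Rooted-walk rooted))
        closedC : Closed Adj C
        closedC = Linked⇒Closed {xs = Q ++ z ∷ D₂} (subst (Linked Adj) shape (Linked-join (y ∷ Q) (Bridge.walk br) closing))
        family : SachsFamilyOn (cs ++ Q) (cycle C ∷ pairs D₁)
        family = SachsFamilyOn-↭
          (↭-trans (solve 5 (λ y q z d₂ d₁ → (y ⊕ q ⊕ z ⊕ d₂) ⊕ d₁ ⊜ (y ⊕ d₁ ⊕ z ⊕ d₂) ⊕ q)
                          ↭-refl [ y ] Q [ z ] D₂ D₁)
                   (++⁺ʳ Q (proj₁ rooted)))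
          (SachsFamilyOn-++ (cycle-family (3≤length-∷-++ y Q z d D₂′) closedC)
                            (pairs-family evenD₁ (Linked-++⁻ˡ D₁ (Rooted-inner rooted))))
        block : Block S ps (cs ++ Q)
        block = piece-block-++ c∈ (∈-resp-↭ (proj₁ rooted) (here refl)) (Bridge.y∉ br) (Bridge.block br)

      ¬same-cycle-bridge : cycle cs ∈ ps → y ∈ cs → z ∈ cs → y ≢ z → Bridge y z Q → ⊥
      ¬same-cycle-bridge {cs} {y} {z} c∈ y∈ z∈ y≢z br with root c∈ y∈
      ... | D , rooted with ∈-resp-↭ (↭-sym (proj₁ rooted)) z∈
      ...   | here z≡y = y≢z (sym z≡y)
      ...   | there z∈D with ∈-∃++ z∈D
      ...     | D₁ , D₂ , refl with parityOf D₁ in e₁ | parityOf D₂ in e₂ | parityOf-pivot-even D₁ z D₂ (Rooted-even c∈ rooted)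
      ...       | 0ℙ | 1ℙ | _ = ¬chord-bridge c∈ rooted e₁ e₂ br
      ...       | 1ℙ | 0ℙ | _ = ¬chord-bridge c∈ (subst (Rooted y cs) (reverse-pivot D₁ z D₂) (Rooted-reverse rooted))
                    (trans (parityOf-reverse D₂) e₂) (trans (parityOf-reverse D₁) e₁) br

      pairs-head : ∀ Q → Edge (pairs (y ∷ Q ∷ʳ z)) y (headOr z Q)
      pairs-head []      = here (inj₁ (refl , refl))
      pairs-head (_ ∷ _) = here (inj₁ (refl , refl))

      ¬cross-bridge : ∀ {cy cz} → cycle cy ∈ ps → y ∈ cy → cycle cz ∈ ps → z ∈ cz → z ∉ cy → Bridge y z Q → ⊥
      ¬cross-bridge {y} {z} {Q} {cy} {cz} cy∈ y∈ cz∈ z∈ z∉cy br =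
        Bridge.fresh br (rearranged-edge block family (Any.++⁺ˡ (pairs-head Q)))
        where
        Dy = proj₁ (root cy∈ y∈)
        Dz = proj₁ (root cz∈ z∈)
        rootedY = proj₂ (root cy∈ y∈)
        rootedZ = proj₂ (root cz∈ z∈)
        family : SachsFamilyOn (cy ++ cz ++ Q) (pairs (y ∷ Q ∷ʳ z) ++ pairs Dy ++ pairs Dz)
        family = SachsFamilyOn-↭
          (↭-trans (solve 5 (λ y q z dy dz → (y ⊕ q ⊕ z) ⊕ dy ⊕ dz ⊜ (y ⊕ dy) ⊕ (z ⊕ dz) ⊕ q) ↭-refl [ y ] Q [ z ] Dy Dz)
                   (++⁺ (proj₁ rootedY) (++⁺ʳ Q (proj₁ rootedZ))))
          (SachsFamilyOn-++ (pairs-family (trans (parityOf-∷-∷ʳ y Q z) (Bridge.even br)) (Bridge.walk br))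
            (SachsFamilyOn-++ (pairs-family (Rooted-even cy∈ rootedY) (Rooted-inner rootedY))
                              (pairs-family (Rooted-even cz∈ rootedZ) (Rooted-inner rootedZ))))
        y∉ : y ∉ cz ++ Q
        y∉ y∈′ = [ (λ y∈cz → z∉cy (Block.saturated (piece-block cy∈) cz∈ y∈cz z∈ y∈)) , Bridge.y∉ br ]′
                   (∈-++⁻ cz y∈′)
        block : Block S ps (cy ++ cz ++ Q)
        block = piece-block-++ cy∈ y∈ y∉ (piece-block-++ cz∈ z∈ (Bridge.z∉ br) (Bridge.block br))

      ¬bridge : ∀ {cy cz} → cycle cy ∈ ps → y ∈ cy → cycle cz ∈ ps → z ∈ cz → Bridge y z Q → ⊥
      ¬bridge {y} {z} {cy = cy} cy∈ y∈ cz∈ z∈ br with y ≟ z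
      ... | yes refl = ¬loop-bridge cy∈ y∈ br
      ... | no y≢z with z ∈? cy
      ...   | yes z∈cy = ¬same-cycle-bridge cy∈ y∈ z∈cy y≢z br
      ...   | no z∉cy  = ¬cross-bridge cy∈ y∈ cz∈ z∈ z∉cy br


module AlternatingPaths {n : ℕ} (G : Graph n) where

  open Sachs G
  open Rigidity G
  open import Data.List.Membership.DecPropositional (_≟_ {n}) using (_∈?_)
  module ↭-Solver = Algebra.Solver.CommutativeMonoid (++-commutativeMonoid {A = V})
  module ≡-Solver = Algebra.Solver.Monoid (++-monoid V)

  private variable
    u v w x y z c c′ h : V
    S : VSet n
    ps : List (Piece n)
    xs ys Q R T : List V

  MinDegree : VSet n → Set
  MinDegree S = ∀ {x y} → S x ≡ true → S y ≡ true → Adj x y → ∃[ w ] (S w ≡ true × Adj x w × w ≢ y)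

  module _ {S : VSet n} {ps : List (Piece n)} (sf : IsSachsFamily S ps) where

    open IsSachsFamily sf

    StartsMatched : List V → Set
    StartsMatched (x ∷ y ∷ _) = ∀ {c} → Edge ps x c → c ≡ y
    StartsMatched _           = ⊥

    StartsMatched-++ : ∀ xs → StartsMatched xs → StartsMatched (xs ++ ys)
    StartsMatched-++ (_ ∷ _ ∷ _) m = m

    record AlternatingPath (Q : List V) : Set where
      field
        walk  : Linked Adj Q
        block : Block S ps Q
        even  : parityOf Q ≡ 0ℙ
        front : StartsMatched Q
        back  : StartsMatched (reverse Q)

    open AlternatingPath

    AlternatingPath-reverse : AlternatingPath Q → AlternatingPath (reverse Q)
    AlternatingPath-reverse {Q} P = record
      { walk  = Linked-reverse Adj-sym (walk P)
      ; block = Block-↭ (↭-sym (↭-reverse Q)) (block P)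
      ; even  = trans (parityOf-reverse Q) (even P)
      ; front = back P
      ; back  = subst StartsMatched (sym (reverse-involutive Q)) (front P)
      }

    matched-path : k2 x y ∈ ps → AlternatingPath (x ∷ y ∷ [])
    matched-path m = record
      { walk  = piece-Adj sf m (inj₁ (refl , refl)) ∷ [-]
      ; block = piece-block sf m
      ; even  = refl
      ; front = Matched-only disjoint (inj₁ m)
      ; back  = Matched-only disjoint (inj₂ m)
      }

    matched-block-∷ : Matched ps c c′ → c ∉ Q → Block S ps Q → Block S ps (c′ ∷ c ∷ Q)
    matched-block-∷ (inj₁ m) c∉ b = Block-↭ (swap _ _ ↭-refl) (piece-block-++ sf m (here refl) c∉ b)
    matched-block-∷ (inj₂ m) c∉ b = piece-block-++ sf m (there (here refl)) c∉ b

    grow : ∀ {q₀ q₁} → AlternatingPath (q₀ ∷ q₁ ∷ R) → Adj q₀ c → c ∉ q₀ ∷ q₁ ∷ R → Matched ps c c′ →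
           AlternatingPath (c′ ∷ c ∷ q₀ ∷ q₁ ∷ R)
    grow {R} {c} {c′} {q₀} {q₁} P q₀c c∉ m = record
      { walk  = adjacent (Matched⇒Edge (Matched-sym m)) ∷ Adj-sym q₀c ∷ walk P
      ; block = matched-block-∷ m c∉ (block P)
      ; even  = even P
      ; front = Matched-only disjoint (Matched-sym m)
      ; back  = subst StartsMatched (sym (reverse-++ (c′ ∷ c ∷ []) (q₀ ∷ q₁ ∷ R)))
                  (StartsMatched-++ (reverse (q₀ ∷ q₁ ∷ R)) (back P))
      }

    Stuck : List V → Set
    Stuck Q@(q₀ ∷ q₁ ∷ _) = ∃[ c ] (Adj q₀ c × c ≢ q₁ × (c ∈ Q ⊎ (OnCycle ps c × c ∉ Q)))
    Stuck _                = ⊥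

    Stuck-++ : ∀ Q → Stuck Q → Stuck (Q ++ R)
    Stuck-++ (_ ∷ _ ∷ _) (c , q₀c , c≢q₁ , inj₁ c∈) = c , q₀c , c≢q₁ , inj₁ (∈-++⁺ˡ c∈)
    Stuck-++ {R} Q@(_ ∷ _ ∷ _) (c , q₀c , c≢q₁ , inj₂ (onCycle , _)) with c ∈? Q ++ R
    ... | yes c∈ = c , q₀c , c≢q₁ , inj₁ c∈
    ... | no c∉  = c , q₀c , c≢q₁ , inj₂ (onCycle , c∉)

    module _ (minDegree : MinDegree S) where

      -- The fuel k is enough because an alternating path has no repeated vertex.
      extend : ∀ k → n ≤ length Q + k → AlternatingPath Q → ∃[ ext ] (AlternatingPath (ext ++ Q) × Stuck (ext ++ Q))
      extend {[]}    _ _ P = ⊥-elim (front P)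
      extend {_ ∷ []} _ _ P = ⊥-elim (front P)
      extend {Q@(q₀ ∷ q₁ ∷ R)} k bound P with walk P
      ... | q₀q₁ ∷ _ with minDegree (Block.inS (block P) (here refl)) (Block.inS (block P) (there (here refl))) q₀q₁
      ... | c , Sc , q₀c , c≢q₁ with c ∈? Q
      ...   | yes c∈ = [] , P , c , q₀c , c≢q₁ , inj₁ c∈
      ...   | no c∉ with matched-or-on-cycle (covers Sc)
      ...     | inj₂ onCycle = [] , P , c , q₀c , c≢q₁ , inj₂ (onCycle , c∉)
      ...     | inj₁ (c′ , m) with k
      ...       | zero = ⊥-elim (1+n≰n (≤-trans (n≤1+n _) (≤-trans (Unique-Fin⇒length≤ (Block.unique (block grown)))
                                                                (subst (n ≤_) (+-identityʳ (length Q)) bound))))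
        where grown = grow P q₀c c∉ m
      ...       | suc k with extend k (≤-trans (subst (n ≤_) (+-suc (length Q) k) bound) (n≤1+n _)) (grow P q₀c c∉ m)
      ...         | ext , P′ , stuck = ext ++ c′ ∷ c ∷ [] ,
                      subst (λ l → AlternatingPath l × Stuck l) (sym (++-assoc ext (c′ ∷ c ∷ []) Q)) (P′ , stuck)

    -- How a path that cannot be extended at its front h gets stuck: an edge c h closes an odd prefix h F c
    -- into a blossom, or leads to a vertex c on a cycle of the family outside the path.
    data FrontEnd : List V → Set where
      blossom : ∀ {h F c B} → parityOf F ≡ 1ℙ → Closed Adj (h ∷ F ∷ʳ c) → ¬ Edge ps h c → FrontEnd (h ∷ F ++ c ∷ B)
      exit    : ∀ {h T c cs} → cycle cs ∈ ps → c ∈ cs → c ∉ h ∷ T → Adj c h → ¬ Edge ps c h → FrontEnd (h ∷ T)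

    closing-edge : ∀ h F c {rest} → Edge (cycle (h ∷ F ∷ʳ c) ∷ rest) h c
    closing-edge h F c = here (Cyclic⇒CycEdge (h ∷ F ∷ʳ c) (inj₂ (Cyclic-closing h F c)))

    module _ (unique : SachsUnique S) where

      front-end : AlternatingPath Q → Stuck Q → FrontEnd Q
      front-end {_ ∷ _ ∷ _} P (c , q₀c , c≢q₁ , inj₂ ((_ , c∈ , c∈cs) , c∉)) =
        exit c∈ c∈cs c∉ (Adj-sym q₀c) (c≢q₁ ∘ front P ∘ Edge-sym)
      front-end {q₀ ∷ q₁ ∷ _} P (c , q₀c , c≢q₁ , inj₁ c∈) with ∈-∃++ c∈
      ... | []         , _ , refl = ⊥-elim (Adj-irrefl q₀c refl)
      ... | _ ∷ []     , _ , refl = ⊥-elim (c≢q₁ refl)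
      ... | _ ∷ _ ∷ A , B , refl with parityOf (q₁ ∷ A) in parityF
      ...   | 1ℙ = blossom {F = q₁ ∷ A} parityF closed (c≢q₁ ∘ front P)
        where
        closed = Linked⇒Closed {xs = q₁ ∷ A ∷ʳ c} (Linked-∷ʳ (q₀ ∷ q₁ ∷ A) (Linked-prefix (q₁ ∷ A) (walk P)) (Adj-sym q₀c))
      ...   | 0ℙ = ⊥-elim (c≢q₁ (front P (rearranged-edge sf unique (block P) family (closing-edge q₀ (q₁ ∷ A) c))))
        where
        F = q₁ ∷ A
        evenB : parityOf B ≡ 0ℙ
        evenB = trans (parityOf-∷-pivot-even q₀ F c B (even P)) parityF
        family : SachsFamilyOn (q₀ ∷ F ++ c ∷ B) (cycle (q₀ ∷ F ∷ʳ c) ∷ pairs B)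
        family = SachsFamilyOn-↭ (↭-reflexive (cong (q₀ ∷_) (++-assoc F [ c ] B)))
          (SachsFamilyOn-++ (cycle-family (3≤length-closing q₀ q₁ A c)
                              (Linked⇒Closed {xs = F ∷ʳ c} (Linked-∷ʳ (q₀ ∷ F) (Linked-prefix F (walk P)) (Adj-sym q₀c))))
                            (pairs-family evenB (Linked.tail (Linked-++⁻ʳ (q₀ ∷ F) (walk P)))))

      blossom-length : ∀ (h : V) F (c : V) → parityOf F ≡ 1ℙ → 3 ≤ length (h ∷ F ∷ʳ c)
      blossom-length h (f ∷ F) c _ = 3≤length-closing h f F c

      ¬blossom-exit : ∀ {F B cm cs} → AlternatingPath (h ∷ F ++ c ∷ B) → parityOf F ≡ 1ℙ → Closed Adj (h ∷ F ∷ʳ c) →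
        ¬ Edge ps h c → cycle cs ∈ ps → cm ∈ cs → cm ∉ h ∷ F ++ c ∷ B → Linked Adj ((h ∷ F ++ c ∷ B) ∷ʳ cm) → ⊥
      ¬blossom-exit {h} {c} {F} {B} {cm} {cs} P oddF closedF fresh cs∈ cm∈ cm∉ walk′ =
        fresh (rearranged-edge sf unique (piece-block-++ sf cs∈ cm∈ cm∉ (block P)) family (closing-edge h F c))
        where
        D = proj₁ (root sf cs∈ cm∈)
        rooted = proj₂ (root sf cs∈ cm∈)
        evenBcm : parityOf (B ∷ʳ cm) ≡ 0ℙ
        evenBcm = trans (parityOf-∷ʳ B cm) (cong _⁻¹ (trans (parityOf-∷-pivot-even h F c B (even P)) oddF))
        walkBcm : Linked Adj (B ∷ʳ cm)
        walkBcm = Linked.tail (Linked-++⁻ʳ (h ∷ F) (subst (Linked Adj) (cong (h ∷_) (++-assoc F (c ∷ B) [ cm ])) walk′))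
        family : SachsFamilyOn (cs ++ h ∷ F ++ c ∷ B) (cycle (h ∷ F ∷ʳ c) ∷ pairs (B ∷ʳ cm) ++ pairs D)
        family = SachsFamilyOn-↭
          (↭-trans (solve 6 (λ h f c b m d → (h ⊕ f ⊕ c) ⊕ (b ⊕ m) ⊕ d ⊜ (m ⊕ d) ⊕ h ⊕ f ⊕ c ⊕ b)
                          ↭-refl [ h ] F [ c ] B [ cm ] D)
                   (++⁺ʳ _ (proj₁ rooted)))
          (SachsFamilyOn-++ (cycle-family (blossom-length h F c oddF) closedF)
            (SachsFamilyOn-++ (pairs-family evenBcm walkBcm) (pairs-family (Rooted-even sf unique cs∈ rooted) (Rooted-inner sf rooted))))
          where open ↭-Solver using (solve; _⊜_; _⊕_)

      ¬disjoint-blossoms : ∀ {F M c′ F′ h′} → AlternatingPath (h ∷ F ++ c ∷ M ++ c′ ∷ reverse (h′ ∷ F′)) →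
        parityOf F ≡ 1ℙ → Closed Adj (h ∷ F ∷ʳ c) → ¬ Edge ps h c →
        parityOf F′ ≡ 1ℙ → Closed Adj (h′ ∷ F′ ∷ʳ c′) → ⊥
      ¬disjoint-blossoms {h} {c} {F} {M} {c′} {F′} {h′} P oddF closedF fresh oddF′ closedF′ =
        fresh (rearranged-edge sf unique (block P) family (closing-edge h F c))
        where
        K = h′ ∷ F′
        evenM : parityOf M ≡ 0ℙ
        evenM = trans (parityOf-pivot-odd M c′ (reverse K) (trans (parityOf-∷-pivot-even h F c _ (even P)) oddF))
                      (trans (parityOf-reverse K) (trans (parityOf-∷ h′ F′) (cong _⁻¹ oddF′)))
        family : SachsFamilyOn (h ∷ F ++ c ∷ M ++ c′ ∷ reverse K) (cycle (h ∷ F ∷ʳ c) ∷ cycle (K ∷ʳ c′) ∷ pairs M)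
        family = SachsFamilyOn-↭
          (↭-trans (solve 6 (λ h f c m c′ k → (h ⊕ f ⊕ c) ⊕ (k ⊕ c′) ⊕ m ⊜ h ⊕ f ⊕ c ⊕ m ⊕ c′ ⊕ k)
                          ↭-refl [ h ] F [ c ] M [ c′ ] K)
                   (prep h (++⁺ˡ F (prep c (++⁺ˡ M (prep c′ (↭-sym (↭-reverse K))))))))
          (SachsFamilyOn-++ (cycle-family (blossom-length h F c oddF) closedF)
            (SachsFamilyOn-++ (cycle-family (blossom-length h′ F′ c′ oddF′) closedF′)
                              (pairs-family evenM (Linked-++⁻ˡ M (Linked.tail (Linked-++⁻ʳ (h ∷ F) (walk P)))))))
          where open ↭-Solver using (solve; _⊜_; _⊕_)

      ¬overlapping-blossoms : ∀ {Pre c′ M B h′} → AlternatingPath (h ∷ Pre ++ c′ ∷ M ++ c ∷ B ∷ʳ h′) →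
        parityOf M ≡ 0ℙ → Adj c h → Adj c′ h′ → ¬ Edge ps h c → ⊥
      ¬overlapping-blossoms {h} {c} {Pre} {c′} {M} {B} {h′} P evenM ch c′h′ fresh =
        fresh (rearranged-edge sf unique (block P) family (closing-edge h X c))
        where
        X = Pre ++ c′ ∷ h′ ∷ reverse B
        upper : Linked Adj (h ∷ Pre ∷ʳ c′)
        upper = Linked-prefix Pre (walk P)
        middle : Linked Adj (c′ ∷ M ++ c ∷ B ∷ʳ h′)
        middle = Linked-++⁻ʳ (h ∷ Pre) (walk P)
        lower : Linked Adj (h′ ∷ reverse B ∷ʳ c)
        lower = subst (Linked Adj) (trans (reverse-++ (c ∷ B) [ h′ ]) (cong (h′ ∷_) (unfold-reverse c B)))
                      (Linked-reverse Adj-sym (Linked-++⁻ʳ M (Linked.tail middle)))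
        closedC : Closed Adj (h ∷ X ∷ʳ c)
        closedC = Linked⇒Closed {xs = X ∷ʳ c}
          (subst (Linked Adj) shape (Linked-join (h ∷ Pre) upper (c′h′ ∷ Linked-∷ʳ (h′ ∷ reverse B) lower ch)))
          where
          open ≡-Solver using (solve; _⊜_; _⊕_)
          shape : h ∷ Pre ++ c′ ∷ (h′ ∷ reverse B ∷ʳ c) ∷ʳ h ≡ (h ∷ X ∷ʳ c) ∷ʳ h
          shape = solve 6 (λ h c c′ h′ p r → h ⊕ p ⊕ c′ ⊕ ((h′ ⊕ r ⊕ c) ⊕ h) ⊜ ((h ⊕ (p ⊕ c′ ⊕ h′ ⊕ r)) ⊕ c) ⊕ h)
                    refl [ h ] [ c ] [ c′ ] [ h′ ] Pre (reverse B)
        length≥3 : 3 ≤ length (h ∷ X ∷ʳ c)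
        length≥3 = subst (λ l → 3 ≤ length l) shape (3≤length-∷-++ h Pre c′ h′ (reverse B ∷ʳ c))
          where
          open ≡-Solver using (solve; _⊜_; _⊕_)
          shape : h ∷ Pre ++ c′ ∷ h′ ∷ reverse B ∷ʳ c ≡ h ∷ X ∷ʳ c
          shape = solve 6 (λ h c c′ h′ p r → h ⊕ p ⊕ c′ ⊕ h′ ⊕ (r ⊕ c) ⊜ h ⊕ (p ⊕ c′ ⊕ h′ ⊕ r) ⊕ c)
                    refl [ h ] [ c ] [ c′ ] [ h′ ] Pre (reverse B)
        family : SachsFamilyOn (h ∷ Pre ++ c′ ∷ M ++ c ∷ B ∷ʳ h′) (cycle (h ∷ X ∷ʳ c) ∷ pairs M)
        family = SachsFamilyOn-↭
          (↭-trans (solve 7 (λ h c c′ h′ p r m → (h ⊕ (p ⊕ c′ ⊕ h′ ⊕ r) ⊕ c) ⊕ m ⊜ h ⊕ p ⊕ c′ ⊕ m ⊕ c ⊕ r ⊕ h′)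
                          ↭-refl [ h ] [ c ] [ c′ ] [ h′ ] Pre (reverse B) M)
                   (prep h (++⁺ˡ Pre (prep c′ (++⁺ˡ M (prep c (++⁺ʳ [ h′ ] (↭-reverse B))))))))
          (SachsFamilyOn-++ (cycle-family length≥3 closedC)
                            (pairs-family evenM (Linked-++⁻ˡ M (Linked.tail middle))))
          where open ↭-Solver using (solve; _⊜_; _⊕_)

      middle-even : ∀ {F B M h′ F′} → AlternatingPath (h ∷ F ++ c ∷ B) → parityOf F ≡ 1ℙ → parityOf F′ ≡ 1ℙ →
        reverse (h′ ∷ F′) ≡ M ++ c ∷ B → parityOf M ≡ 0ℙ
      middle-even {h} {c} {F} {B} {M} {h′} {F′} P oddF oddF′ back≡ =
        trans (parityOf-pivot-even M c B (trans (cong parityOf (sym back≡)) evenK))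
              (cong _⁻¹ (trans (parityOf-∷-pivot-even h F c B (even P)) oddF))
        where evenK = trans (parityOf-reverse (h′ ∷ F′)) (trans (parityOf-∷ h′ F′) (cong _⁻¹ oddF′))

      ¬crossing-blossoms : ∀ {F B h′ F′ c′ R M} → AlternatingPath (h ∷ F ++ c ∷ B) → h ∷ F ≡ R ++ c′ ∷ M →
        reverse (h′ ∷ F′) ≡ M ++ c ∷ B → parityOf F ≡ 1ℙ → Closed Adj (h ∷ F ∷ʳ c) → ¬ Edge ps h c →
        parityOf F′ ≡ 1ℙ → Closed Adj (h′ ∷ F′ ∷ʳ c′) → ⊥
      ¬crossing-blossoms {h′ = h′} {F′} {R = []} P refl back≡ oddF _ _ oddF′ _
        with trans (sym oddF) (middle-even {h′ = h′} {F′} P oddF oddF′ back≡)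
      ... | ()
      ¬crossing-blossoms {h} {c} {B = B} {h′} {F′} {c′} {_ ∷ Pre} {M} P refl back≡ oddF closedF fresh oddF′ closedF′ with initLast B
      ... | [] with trans (parityOf-∷-pivot-even h (Pre ++ c′ ∷ M) c [] (even P)) oddF
      ...   | ()
      ¬crossing-blossoms {h} {c} {B = _} {h′} {F′} {c′} {_ ∷ Pre} {M} P refl back≡ oddF closedF fresh oddF′ closedF′
        | B₀ ∷ʳ′ b with ∷ʳ-injective (reverse F′) (M ++ c ∷ B₀)
                          (trans (sym (unfold-reverse h′ F′)) (trans back≡ (sym (++-assoc M (c ∷ B₀) [ b ]))))
      ... | _ , refl =
        ¬overlapping-blossoms (subst AlternatingPath (cong (h ∷_) (++-assoc Pre (c′ ∷ M) (c ∷ B₀ ∷ʳ h′))) P)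
          (middle-even {h′ = h′} {F′} P oddF oddF′ back≡)
          (closedF (Cyclic-closing h (Pre ++ c′ ∷ M) c)) (closedF′ (Cyclic-closing h′ F′ c′)) fresh

      ¬two-blossoms : ∀ {F B h′ F′ c′ B′} → AlternatingPath (h ∷ F ++ c ∷ B) →
        reverse (h ∷ F ++ c ∷ B) ≡ h′ ∷ F′ ++ c′ ∷ B′ → parityOf F ≡ 1ℙ → Closed Adj (h ∷ F ∷ʳ c) → ¬ Edge ps h c →
        parityOf F′ ≡ 1ℙ → Closed Adj (h′ ∷ F′ ∷ʳ c′) → ⊥
      ¬two-blossoms {h} {c} {F} {B} {h′} {F′} {c′} {B′} P eq oddF closedF fresh oddF′ closedF′
        with pivot-cases (h ∷ F) c B (reverse B′) c′ (reverse (h′ ∷ F′))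
               (trans (sym (reverse-involutive _)) (trans (cong reverse eq) (reverse-pivot (h′ ∷ F′) c′ B′)))
      ... | inj₁ (_ , _ , refl) with trans (sym (trans (parityOf-∷-pivot-even h F c _ (even P)) oddF))
                                         (trans (parityOf-reverse (h′ ∷ F′)) (trans (parityOf-∷ h′ F′) (cong _⁻¹ oddF′)))
      ...   | ()
      ¬two-blossoms P eq oddF closedF fresh oddF′ closedF′ | inj₂ (inj₁ (_ , _ , refl)) =
        ¬disjoint-blossoms P oddF closedF fresh oddF′ closedF′
      ¬two-blossoms P eq oddF closedF fresh oddF′ closedF′ | inj₂ (inj₂ (_ , front≡ , back≡)) =
        ¬crossing-blossoms P front≡ back≡ oddF closedF fresh oddF′ closedF′

      back-exit-walk : AlternatingPath Q → h ∷ T ≡ reverse Q → Adj c h → Linked Adj (Q ∷ʳ c)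
      back-exit-walk {Q} {h} {T} {c} P eq ch =
        subst (Linked Adj) (trans (unfold-reverse c (reverse Q)) (cong (_∷ʳ c) (reverse-involutive Q)))
          (Linked-reverse Adj-sym (subst (Linked Adj ∘ (c ∷_)) eq (ch ∷ subst (Linked Adj) (sym eq) (walk (AlternatingPath-reverse P)))))

      ∉-reversed : R ≡ reverse Q → x ∉ R → x ∉ Q
      ∉-reversed {x = x} eq x∉ = x∉ ∘ subst (x ∈_) (sym eq) ∘ Any.reverse⁺

      ¬ends : ∀ {Q′} → AlternatingPath Q → FrontEnd Q → FrontEnd Q′ → Q′ ≡ reverse Q → ⊥
      ¬ends P (exit cy∈ c∈ c∉ ch fresh) (exit cz∈ cm∈ cm∉ cmh _) eq =
        ¬bridge sf unique cy∈ c∈ cz∈ cm∈ record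
          { block = block P ; even = even P ; y∉ = c∉ ; z∉ = ∉-reversed eq cm∉
          ; walk  = ch ∷ back-exit-walk P eq cmh ; fresh = fresh }
      ¬ends P (blossom oddF closedF fresh) (exit cz∈ cm∈ cm∉ cmh _) eq =
        ¬blossom-exit P oddF closedF fresh cz∈ cm∈ (∉-reversed eq cm∉) (back-exit-walk P eq cmh)
      ¬ends {Q} P (exit cy∈ c∈ c∉ ch _) (blossom oddF′ closedF′ fresh′) eq =
        ¬blossom-exit P′ oddF′ closedF′ fresh′ cy∈ c∈ (∉-reversed unreversed c∉) (back-exit-walk P′ unreversed ch)
        where
        P′ = subst AlternatingPath (sym eq) (AlternatingPath-reverse P)
        unreversed = sym (trans (cong reverse eq) (reverse-involutive Q))
      ¬ends P (blossom oddF closedF fresh) (blossom oddF′ closedF′ _) eq =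
        ¬two-blossoms P (sym eq) oddF closedF fresh oddF′ closedF′

      ¬matched-edge : MinDegree S → ¬ k2 x y ∈ ps
      ¬matched-edge minDegree m with extend minDegree n (m≤n+m n 2) (matched-path m)
      ... | ext₁ , P₁ , stuck₁ with extend minDegree n (m≤n+m n _) (AlternatingPath-reverse P₁)
      ... | ext₂ , P₂ , stuck₂ =
        ¬ends P₂ (front-end P₂ stuck₂) (front-end (AlternatingPath-reverse P₂) (subst Stuck (sym reversed) (Stuck-++ _ stuck₁))) refl
        where
        Q₁ = ext₁ ++ _ ∷ _ ∷ []
        reversed : reverse (ext₂ ++ reverse Q₁) ≡ Q₁ ++ reverse ext₂
        reversed = trans (reverse-++ ext₂ (reverse Q₁)) (cong (_++ reverse ext₂) (reverse-involutive Q₁))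


module PendantReduction {n : ℕ} (G : Graph n) where

  open Sachs G
  open Rigidity G
  open AlternatingPaths G

  private variable
    u v w x y : V
    S S′ : VSet n
    ps : List (Piece n)

  Pendant : VSet n → V → V → Set
  Pendant S u v = S u ≡ true × S v ≡ true × Adj u v × (∀ w → S w ≡ true → Adj u w → w ≡ v)

  delete : VSet n → V → V → VSet n
  delete S u v w = S w ∧ (not ⌊ w ≟ u ⌋ ∧ not ⌊ w ≟ v ⌋)

  record Removes (S′ S : VSet n) (u v : V) : Set where
    constructor removes
    field pointwise : ∀ w → S′ w ≡ delete S u v w

  removes⁻ : Removes S′ S u v → S′ x ≡ true → S x ≡ true × x ∉ u ∷ v ∷ []
  removes⁻ {S′} {S} {u} {v} {x} (removes eq) S′x with S x | x ≟ u | x ≟ v | trans (sym (eq x)) S′x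
  ... | true | no x≢u | no x≢v | _ = refl , λ { (here x≡u) → x≢u x≡u ; (there (here x≡v)) → x≢v x≡v }

  removes⁺ : Removes S′ S u v → S x ≡ true → x ∉ u ∷ v ∷ [] → S′ x ≡ true
  removes⁺ {S′} {S} {u} {v} {x} (removes eq) Sx x∉ with S x | x ≟ u | x ≟ v | eq x
  ... | true | no _      | no _      | e = e
  ... | true | yes x≡u  | _         | _ = ⊥-elim (x∉ (here x≡u))
  ... | true | no _      | yes x≡v  | _ = ⊥-elim (x∉ (there (here x≡v)))

  pendant-matched : IsSachsFamily S ps → Pendant S u v → Matched ps u v
  pendant-matched {S} {ps} {u} sf (Su , _ , _ , only) with find (∈-concatMap⁻ verts {xs = ps} (IsSachsFamily.covers sf Su))
  ... | k2 _ y , m , here refl with only y (piece-inS sf m (there (here refl))) (piece-Adj sf m (inj₁ (refl , refl)))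
  ...   | refl = inj₁ m
  pendant-matched sf (Su , _ , _ , only) | k2 y _ , m , there (here refl)
    with only y (piece-inS sf m (here refl)) (piece-Adj sf m (inj₂ (refl , refl)))
  ...   | refl = inj₂ m
  pendant-matched {S} sf (Su , _ , _ , only) | cycle cs , m , u∈
    with cycle-neighbours (Block.unique (piece-block sf m)) (All.lookup (IsSachsFamily.wellFormed sf) m) u∈
  ... | y , z , y≢z , succ , pred , _ =
    ⊥-elim (y≢z (trans (only y (piece-inS sf m (Cyclic-∈ʳ cs succ)) (cycle-Closed sf m succ))
                       (sym (only z (piece-inS sf m (Cyclic-∈ˡ cs pred)) (Adj-sym (cycle-Closed sf m pred))))))

  extended-family : Pendant S u v → Removes S′ S u v → IsSachsFamily S′ ps → IsSachsFamily S (k2 u v ∷ ps)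
  extended-family {S} {u} {v} {S′} {ps} (Su , Sv , uv , _) rem sf = record
    { wellFormed = _ ∷ wellFormed
    ; disjoint   = Unique-∷⁺ u∉ (Unique-∷⁺ (λ v∈ → proj₂ (removed v∈) (there (here refl))) disjoint)
    ; covers     = covers′
    ; inside     = λ { (here refl) → Su ; (there (here refl)) → Sv ; (there (there x∈)) → proj₁ (removed x∈) }
    ; adjacent   = λ { (here (inj₁ (refl , refl))) → uv ; (here (inj₂ (refl , refl))) → Adj-sym uv ; (there e) → adjacent e }
    }
    where
    open IsSachsFamily sf
    removed : x ∈ vertices ps → S x ≡ true × x ∉ u ∷ v ∷ []
    removed = removes⁻ rem ∘ inside
    u∉ : u ∉ v ∷ vertices ps
    u∉ (here u≡v) = Adj-irrefl uv u≡v
    u∉ (there u∈) = proj₂ (removed u∈) (here refl)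
    covers′ : S x ≡ true → x ∈ u ∷ v ∷ vertices ps
    covers′ {x} Sx with x ≟ u | x ≟ v
    ... | yes x≡u | _       = here x≡u
    ... | no _    | yes x≡v = there (here x≡v)
    ... | no x≢u  | no x≢v  =
      there (there (covers (removes⁺ rem Sx λ { (here x≡u) → x≢u x≡u ; (there (here x≡v)) → x≢v x≡v })))

  module _ {S : VSet n} {ps : List (Piece n)} (sf : IsSachsFamily S ps) (pend : Pendant S u v) (rem : Removes S′ S u v) where

    private
      saturated = Block.saturated (matched-block sf (pendant-matched sf pend))

    deleted-family : IsSachsFamily S′ (untouched (u ∷ v ∷ []) ps)
    deleted-family = restrict sf saturated (removes⁻ rem) (removes⁺ rem)

    deleted-shorter : length (untouched (u ∷ v ∷ []) ps) < length ps
    deleted-shorter with pendant-matched sf pend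
    ... | inj₁ m = filter-notAll _ ps (lose m (λ misses → misses (here (here refl))))
    ... | inj₂ m = filter-notAll _ ps (lose m (λ misses → misses (there (here (here refl)))))

    deleted-Edge : Edge ps x y → PieceEdge (k2 u v) x y ⊎ Edge (untouched (u ∷ v ∷ []) ps) x y
    deleted-Edge e with Edge-untouched sf saturated (removes⁻ rem) (removes⁺ rem) e
    ... | inj₁ (p , p∈ , meets , pe) = inj₁ (Matched-piece (IsSachsFamily.disjoint sf) (pendant-matched sf pend) p∈ meets pe)
    ... | inj₂ e′                    = inj₂ e′

  deleted-unique : SachsUnique S → Pendant S u v → Removes S′ S u v → SachsUnique S′
  deleted-unique {u = u} {v = v} uniq pend rem sf₁ sf₂ e
    with uniq (extended-family pend rem sf₁) (extended-family pend rem sf₂) (there e)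
  ... | there e′ = e′
  ... | here pe  = ⊥-elim (proj₂ (removes⁻ rem (IsSachsFamily.inside sf₁ (Edge-∈ˡ e))) (PieceEdge-∈ˡ (k2 u v) pe))

  added-unique : SachsUnique S′ → Pendant S u v → Removes S′ S u v → SachsUnique S
  added-unique uniq′ pend rem sf₁ sf₂ e with deleted-Edge sf₁ pend rem e
  ... | inj₁ pe = Matched-PieceEdge (pendant-matched sf₂ pend) pe
  ... | inj₂ e′ = untouched-Edge sf₂ (Block.saturated (matched-block sf₂ (pendant-matched sf₂ pend))) (removes⁻ rem) (removes⁺ rem)
                    (uniq′ (deleted-family sf₁ pend rem) (deleted-family sf₂ pend rem) e′)

  removes-delete : Removes (delete S u v) S u v
  removes-delete = removes λ _ → refl

  Pendant? : ∀ S u v → Dec (Pendant S u v)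
  Pendant? S u v = (S u ≟ᵇ true) ×-dec (S v ≟ᵇ true) ×-dec (adj G u v ≟ᵇ true) ×-dec
                   all? (λ w → (S w ≟ᵇ true) →-dec (adj G u w ≟ᵇ true) →-dec (w ≟ v))

  no-pendant⇒MinDegree : ¬ (∃[ u ] ∃[ v ] Pendant S u v) → MinDegree S
  no-pendant⇒MinDegree {S} none {x} {y} Sx Sy xy
    with ¬∀⟶∃¬ n _ (λ w → (S w ≟ᵇ true) →-dec (adj G x w ≟ᵇ true) →-dec (w ≟ y))
                   (λ only → none (x , y , Sx , Sy , xy , only))
  ... | w , ¬only with S w ≟ᵇ true | adj G x w ≟ᵇ true | w ≟ y
  ...   | yes Sw  | yes xw  | no w≢y  = w , Sw , xw , w≢y
  ...   | yes _   | yes _   | yes w≡y = ⊥-elim (¬only λ _ _ → w≡y)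
  ...   | yes _   | no ¬xw  | _       = ⊥-elim (¬only λ _ xw → ⊥-elim (¬xw xw))
  ...   | no ¬Sw  | _       | _       = ⊥-elim (¬only λ Sw → ⊥-elim (¬Sw Sw))

  module _ {S : VSet n} {ps : List (Piece n)} (sf : IsSachsFamily S ps) (uniq : SachsUnique S) (minDegree : MinDegree S) where

    open IsSachsFamily sf

    on-cycle : S x ≡ true → OnCycle ps x
    on-cycle Sx with matched-or-on-cycle (covers Sx)
    ... | inj₁ (_ , inj₁ m) = ⊥-elim (¬matched-edge sf uniq minDegree m)
    ... | inj₁ (_ , inj₂ m) = ⊥-elim (¬matched-edge sf uniq minDegree m)
    ... | inj₂ onCycle      = onCycle

    induced⇒Edge : induced G S x y ≡ true → Edge ps x y
    induced⇒Edge {x} {y} e with Edge? ps x y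
    ... | yes xy = xy
    ... | no ¬xy with induced⁻ {S = S} e
    ...   | xy , Sx , Sy with on-cycle Sx | on-cycle Sy
    ...     | _ , cx∈ , x∈ | _ , cy∈ , y∈ = ⊥-elim (¬bridge sf uniq cx∈ x∈ cy∈ y∈ record
            { block = Block-[] ; even = refl ; y∉ = λ () ; z∉ = λ () ; walk = xy ∷ [-] ; fresh = ¬xy })

    independent-odd-cycles : IndepOddCycles G S
    independent-odd-cycles = ps , decomposition , All.tabulate odd
      where
      decomposition : Decomposition S (induced G S) ps
      decomposition = record
        { wf = wellFormed ; disjoint = disjoint ; cover = λ _ → covers , inside ; edges = λ _ _ → induced⇒Edge , Edge⇒induced sf }
      odd : ∀ {p} → p ∈ ps → IsOddCycle p
      odd {k2 _ _}   m = ¬matched-edge sf uniq minDegree m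
      odd {cycle cs} m = parity≡1ℙ⇒%2≡1 (length cs) (cycle-odd sf uniq m)

  reduce : ∀ k → length ps < k → IsSachsFamily S ps → SachsUnique S →
           ∃[ S′ ] (Star (PendantStep G) S S′ × IndepOddCycles G S′)
  reduce {S = S} (suc k) bound sf uniq with any? (λ u → any? (λ v → Pendant? S u v))
  ... | no none = S , ε , independent-odd-cycles sf uniq (no-pendant⇒MinDegree none)
  ... | yes (u , v , pend@(Su , Sv , uv , only)) with
          reduce k (<-≤-trans (deleted-shorter sf pend removes-delete) (≤-pred bound))
                   (deleted-family sf pend removes-delete) (deleted-unique uniq pend removes-delete)
  ... | S′ , steps , independent = S′ , (u , v , Su , Sv , uv , only , λ _ → refl) ◅ steps , independent


module OddCycleFamilies {n : ℕ} (G : Graph n) where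

  open Sachs G

  private variable
    u v w x y z : V

  module _ {S : VSet n} {qs : List (Piece n)} (dec : Decomposition S (induced G S) qs) (odd : All IsOddCycle qs) where

    open Decomposition dec

    Induced : V → V → Set
    Induced x y = induced G S x y ≡ true

    odd-cycles-family : IsSachsFamily S qs
    odd-cycles-family = record
      { wellFormed = wf
      ; disjoint   = disjoint
      ; covers     = proj₁ (cover _)
      ; inside     = proj₂ (cover _)
      ; adjacent   = λ {u} {v} e → proj₁ (induced⁻ {S = S} (proj₂ (edges u v) e))
      }

    own-cycle : S x ≡ true → ∃[ Q ] (cycle Q ∈ qs × x ∈ Q)
    own-cycle {x} Sx with find (∈-concatMap⁻ verts {xs = qs} (proj₁ (cover x) Sx))
    ... | k2 _ _  , m , _  = ⊥-elim (All.lookup odd m)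
    ... | cycle Q , m , x∈ = Q , m , x∈

    Induced⇒CycEdge : ∀ {Q} → cycle Q ∈ qs → x ∈ Q → Induced x w → CycEdge Q x w
    Induced⇒CycEdge {x} {w} m x∈ i with find (proj₁ (edges x w) i)
    ... | q , q∈ , pe with concatMap-owner verts disjoint m q∈ x∈ (PieceEdge-∈ˡ q pe)
    ...   | refl = pe

    CycEdge⇒Induced : ∀ {Q} → cycle Q ∈ qs → CycEdge Q x w → Induced x w
    CycEdge⇒Induced {x} {w} m e = proj₂ (edges x w) (lose m e)

    two-neighbours : S x ≡ true → ∃[ y ] ∃[ z ] (∀ {w} → Induced x w → w ≡ y ⊎ w ≡ z)
    two-neighbours Sx with own-cycle Sx
    ... | Q , m , x∈ with cycle-neighbours (Unique-concatMap⁻ verts disjoint m) (All.lookup wf m) x∈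
    ...   | y , z , _ , _ , _ , after , before =
      y , z , [ inj₁ ∘ after , inj₂ ∘ before ]′ ∘ CycEdge⇒Cyclic Q ∘ Induced⇒CycEdge m x∈

    module _ {ps : List (Piece n)} (sf : IsSachsFamily S ps) where

      open IsSachsFamily sf renaming (disjoint to disjoint′; wellFormed to wellFormed′)

      cycle-Induced : ∀ {C} → cycle C ∈ ps → x ∈ C → Induced x w → CycEdge C x w
      cycle-Induced {x} {w} {C} m x∈ i with cycle-neighbours (Unique-concatMap⁻ verts disjoint′ m) (All.lookup wellFormed′ m) x∈
      ... | y , z , y≢z , succ , pred , _ with two-neighbours (proj₁ (proj₂ (induced⁻ {S = S} i)))
      ...   | a , b , only with only (Edge⇒induced sf (lose m (Cyclic⇒CycEdge C (inj₁ succ))))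
                              | only (Edge⇒induced sf (lose m (Cyclic⇒CycEdge C (inj₂ pred))))
                              | only i
      ...     | inj₁ refl | inj₁ refl | _         = ⊥-elim (y≢z refl)
      ...     | inj₂ refl | inj₂ refl | _         = ⊥-elim (y≢z refl)
      ...     | inj₁ refl | inj₂ refl | inj₁ refl = Cyclic⇒CycEdge C (inj₁ succ)
      ...     | inj₁ refl | inj₂ refl | inj₂ refl = Cyclic⇒CycEdge C (inj₂ pred)
      ...     | inj₂ refl | inj₁ refl | inj₁ refl = Cyclic⇒CycEdge C (inj₂ pred)
      ...     | inj₂ refl | inj₁ refl | inj₂ refl = Cyclic⇒CycEdge C (inj₁ succ)

      OnCycle-step : Induced x w → OnCycle ps x → OnCycle ps w
      OnCycle-step i (C , m , x∈) = C , m , PieceEdge-∈ʳ (cycle C) (cycle-Induced m x∈ i)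

      matched-cycle-even : ∀ {Q} → cycle Q ∈ qs → (∀ {y} → y ∈ Q → ¬ OnCycle ps y) → parityOf Q ≡ 0ℙ
      matched-cycle-even {Q} mQ offCycle =
        matched⇒even (Matched ps) Matched-sym (λ m₁ m₂ → sym (Matched-only disjoint′ m₁ (Matched⇒Edge m₂)))
          (Adj-irrefl ∘ adjacent ∘ Matched⇒Edge) Q (Unique-concatMap⁻ verts disjoint mQ) partner
        where
        partner : ∀ {y} → y ∈ Q → ∃[ y′ ] (y′ ∈ Q × Matched ps y y′)
        partner y∈ with matched-or-on-cycle (covers (proj₂ (cover _) (∈-concatMap⁺ verts (lose mQ y∈))))
        ... | inj₂ onCycle = ⊥-elim (offCycle y∈ onCycle)
        ... | inj₁ (y′ , m) = y′ , PieceEdge-∈ʳ (cycle Q) (Induced⇒CycEdge mQ y∈ (Edge⇒induced sf (Matched⇒Edge m))) , m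

      off-cycle-along : ∀ {Q} → cycle Q ∈ qs → x ∈ Q → ¬ OnCycle ps x → y ∈ Q → ¬ OnCycle ps y
      off-cycle-along {Q = Q} m x∈ off y∈ onCycle =
        off (Linked-transport OnCycle-step (OnCycle-step ∘ induced-sym {S = S}) walk y∈ x∈ onCycle)
        where walk = Consec⇒Linked Q (CycEdge⇒Induced m ∘ Cyclic⇒CycEdge Q ∘ inj₁ ∘ Consec⇒Cyclic Q)

      -- If x lay on a K₂, no vertex of its odd cycle Q could lie on a cycle of the family, and the K₂'s
      -- would match Q perfectly.
      Induced⇒Edge : Induced x y → Edge ps x y
      Induced⇒Edge i with matched-or-on-cycle (covers (proj₁ (proj₂ (induced⁻ {S = S} i))))
      ... | inj₂ (C , m , x∈) = lose m (cycle-Induced m x∈ i)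
      ... | inj₁ (_ , matched) with own-cycle (proj₁ (proj₂ (induced⁻ {S = S} i)))
      ...   | Q , mQ , x∈Q with trans (sym (matched-cycle-even mQ (off-cycle-along mQ x∈Q (Matched⇒¬OnCycle disjoint′ matched))))
                                      (%2≡1⇒parity≡1ℙ (length Q) (All.lookup odd mQ))
      ...     | ()

    odd-cycles-unique : SachsUnique S
    odd-cycles-unique sf₁ sf₂ = Induced⇒Edge sf₂ ∘ Edge⇒induced sf₁


module Theorem {n : ℕ} (G : Graph n) where

  open Sachs G
  open PendantReduction G
  open OddCycleFamilies G

  edgesOf : List (Piece n) → ERel n
  edgesOf ps u v = does (Edge? ps u v)

  edgesOf⁻ : ∀ {ps u v} → edgesOf ps u v ≡ true → Edge ps u v
  edgesOf⁻ {ps} {u} {v} e with Edge? ps u v | e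
  ... | yes uv | _ = uv

  family⇒IsSachs : ∀ {ps} → IsSachsFamily allV ps → IsSachs G (edgesOf ps)
  family⇒IsSachs {ps} sf = (λ _ _ → adjacent ∘ edgesOf⁻) , ps , record
    { wf = wellFormed ; disjoint = disjoint ; cover = λ _ → (λ _ → covers refl) , (λ _ → refl)
    ; edges = λ u v → edgesOf⁻ , dec-true (Edge? ps u v) }
    where open IsSachsFamily sf

  IsSachs⇒family : ∀ {H ps} → (∀ u v → H u v ≡ true → adj G u v ≡ true) → Decomposition allV H ps → IsSachsFamily allV ps
  IsSachs⇒family sub dec = record
    { wellFormed = wf ; disjoint = disjoint ; covers = proj₁ (cover _) ; inside = proj₂ (cover _)
    ; adjacent = λ {u} {v} → sub u v ∘ proj₂ (edges u v) }
    where open Decomposition dec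

  unique-sachs⇒reducible : UniqueSachs G → ReducibleToOddCycles G
  unique-sachs⇒reducible (H , (sub , ps , dec) , uniqueH) = reduce (suc (length ps)) ≤-refl (IsSachs⇒family sub dec) unique
    where
    unique : SachsUnique allV
    unique {ps₁} {ps₂} sf₁ sf₂ {u} {v} e = edgesOf⁻ (trans (uniqueH _ (family⇒IsSachs sf₂) u v)
      (trans (sym (uniqueH _ (family⇒IsSachs sf₁) u v)) (dec-true (Edge? ps₁ u v) e)))

  reducible⇒family : ∀ {S₀ S} → Star (PendantStep G) S₀ S → IndepOddCycles G S → (∃[ ps ] IsSachsFamily S₀ ps) × SachsUnique S₀
  reducible⇒family ε (qs , dec , odd) = (qs , odd-cycles-family dec odd) , odd-cycles-unique dec odd
  reducible⇒family ((u , v , Su , Sv , uv , only , eq) ◅ steps) independent with reducible⇒family steps independent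
  ... | (ps , sf) , unique = (k2 u v ∷ ps , extended-family pend (removes eq) sf) , added-unique unique pend (removes eq)
    where pend = Su , Sv , uv , only

  reducible⇒unique-sachs : ReducibleToOddCycles G → UniqueSachs G
  reducible⇒unique-sachs (S , steps , independent) with reducible⇒family steps independent
  ... | (ps , sf) , unique = edgesOf ps , family⇒IsSachs sf , only
    where
    only : ∀ H′ → IsSachs G H′ → ∀ u v → H′ u v ≡ edgesOf ps u v
    only H′ (sub′ , ps′ , dec′) u v =
      ⇔→≡ (mk⇔ (dec-true (Edge? ps u v) ∘ unique sf′ sf ∘ proj₁ (Decomposition.edges dec′ u v))
               (proj₂ (Decomposition.edges dec′ u v) ∘ unique sf sf′ ∘ edgesOf⁻))
      where sf′ = IsSachs⇒family sub′ dec′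

theorem3p1 : ∀ (n : ℕ) (G : Graph n) →
    (UniqueSachs G → ReducibleToOddCycles G) × (ReducibleToOddCycles G → UniqueSachs G)
theorem3p1 n G = Theorem.unique-sachs⇒reducible G , Theorem.reducible⇒unique-sachs G
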